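{- On the space $\mathbb{C}A^n$ of linear combinations of words of length $n\ge2$, for every letter $a\in A$ and every $1\le k\le n-1$, $$\partial_a\circ\nu_k-\nu_k\circ\partial_a=(n+1-k)\,\nu_{k-1}\circ\partial_a+\sum_{b\in A}\theta_{a,b}\circ\nu_{k-1}\circ\partial_b,$$ where in $\partial_a\circ\nu_k$ the operator $\nu_k$ acts on words of length $n$, and all other $\nu$'s act on words of length $n-1$.
   Context: $A$ is a finite totally ordered alphabet, and $\mathbb{C}A^m$ is the space with basis the words of length $m$. For a word $w=w_1\cdots w_m$ and letters $a,b$: $\mathrm{sh}_a(w)=\sum_{i=1}^{m+1}w_1\cdots w_{i-1}aw_i\cdots w_m$; $\partial_a(w)=\sum_{i:\,w_i=a}w_1\cdots w_{i-1}w_{i+1}\cdots w_m$; $\theta_{a,b}(w)=\sum_{i:\,w_i=a}w_1\cdots w_{i-1}\,b\,w_{i+1}\cdots w_m$ (replace one occurrence of $a$ by $b$ in all ways); all extended linearly. For $\tau\in S_m$, $w\cdot\tau=w_{\tau(1)}\cdots w_{\tau(m)}$, and $\mathrm{noninv}_i(\tau)$ is the number of increasing subsequences of length $i$ of $\tau(1)\cdots\tau(m)$. For $0\le k\le m$, $\nu_k(w)=\sum_{\tau\in S_m}\mathrm{noninv}_{m-k}(\tau)\,w\cdot\tau$ on $\mathbb{C}A^m$. -}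

module Defs where

open import Data.Nat using (ℕ; zero; suc; _∸_; pred; _<ᵇ_)
open import Data.Integer using (ℤ; +_; _*_; _+_; 0ℤ)
open import Data.Fin using (Fin; toℕ) renaming (_≟_ to _≟ᶠ_)
open import Data.Fin.Properties using () renaming (_≟_ to _≟F_)
open import Data.Vec using (Vec; []; _∷_; lookup; tabulate; removeAt; toList; updateAt)
open import Data.Vec.Properties using (≡-dec)
open import Data.List using (List; []; _∷_; _++_; map; concatMap; allFin; filterᵇ; foldr)
open import Data.Product using (_×_; _,_)
open import Data.Bool using (Bool; true; false; if_then_else_; _∧_; _∨_; not)
open import Data.Maybe using (Maybe; just; nothing)
open import Relation.Nullary.Decidable using (⌊_⌋)

Word : ℕ → ℕ → Set
Word s m = Vec (Fin s) m

-- Formal ℤ-linear combinations of words of length m (finite lists of terms).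
LC : ℕ → ℕ → Set
LC s m = List (ℤ × Word s m)

coeff : ∀ {s m} → LC s m → Word s m → ℤ
coeff [] u = 0ℤ
coeff ((c , v) ∷ xs) u =
  (if ⌊ ≡-dec _≟F_ v u ⌋ then c else 0ℤ) + coeff xs u

scale : ∀ {s m} → ℤ → LC s m → LC s m
scale c = map (λ { (d , v) → (c * d , v) })

lin : ∀ {s m m'} → (Word s m → LC s m') → LC s m → LC s m'
lin f [] = []
lin f ((c , v) ∷ xs) = scale c (f v) ++ lin f xs

basis : ∀ {s m} → Word s m → LC s m
basis w = (+ 1 , w) ∷ []

eqF : ∀ {n} → Fin n → Fin n → Bool
eqF i j = ⌊ i ≟F j ⌋

-- ∂_a : words of length n → words of length n-1 (zero on the empty word).
∂ : ∀ {s n} → Fin s → Word s n → LC s (pred n)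
∂ {n = zero} a w = []
∂ {n = suc n} a w =
  concatMap (λ i → if eqF (lookup w i) a then basis (removeAt w i) else [])
            (allFin (suc n))

θ : ∀ {s n} → Fin s → Fin s → Word s n → LC s n
θ {n = n} a b w =
  concatMap (λ i → if eqF (lookup w i) a then basis (updateAt w i (λ _ → b)) else [])
            (allFin n)

-- All functions Fin m → Fin n, as vectors τ(1)…τ(m).
allVecs : ∀ (n m : ℕ) → List (Vec (Fin n) m)
allVecs n zero = [] ∷ []
allVecs n (suc m) = concatMap (λ x → map (x ∷_) (allVecs n m)) (allFin n)

allᵇ : ∀ {X : Set} → (X → Bool) → List X → Bool
allᵇ p = foldr (λ x r → p x ∧ r) true

-- τ is injective (hence, on Fin m, a permutation).
injectiveᵇ : ∀ {m} → Vec (Fin m) m → Bool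
injectiveᵇ {m} τ =
  allᵇ (λ i → allᵇ (λ j → not (eqF (lookup τ i) (lookup τ j)) ∨ eqF i j) (allFin m)) (allFin m)

-- The symmetric group S_m, listed (each permutation exactly once).
Sym : (m : ℕ) → List (Vec (Fin m) m)
Sym m = filterᵇ injectiveᵇ (allVecs m m)

above : Maybe ℕ → ℕ → Bool
above nothing x = true
above (just y) x = y <ᵇ x

-- Number of strictly increasing subsequences of length i of a list,
-- all of whose entries exceed the optional lower bound.
incFrom : Maybe ℕ → ℕ → List ℕ → ℕ
incFrom b zero xs = 1
incFrom b (suc i) [] = 0
incFrom b (suc i) (x ∷ xs) = incFrom b (suc i) xs Data.Nat.+ rest
  where
  rest : ℕ
  rest = if above b x then incFrom (just x) i xs else 0

-- noninv_i(τ): number of increasing subsequences of length i of τ(1)⋯τ(m).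
noninv : ∀ {m} → ℕ → Vec (Fin m) m → ℕ
noninv i τ = incFrom nothing i (toList (Data.Vec.map toℕ τ))

act : ∀ {s m} → Word s m → Vec (Fin m) m → Word s m
act w τ = tabulate (λ i → lookup w (lookup τ i))

ν : ∀ {s} (m : ℕ) → ℕ → Word s m → LC s m
ν m k w = map (λ τ → (+ noninv (m ∸ k) τ , act w τ)) (Sym m)

module Submission where

-- Compare the coefficients of a fixed word u on both sides; all
-- of them are natural numbers.  Label the letters of w by their positions:
-- w becomes a list of tiles (label, letter) with distinct labels.  Arr b L X u
-- counts the sequences of distinct tiles of X spelling u together with an
-- increasing choice of L of their labels, all above b; the coefficient of u in
-- ν_k(w) is such a count with L = m - k (PermutationCounts).  The three
-- kinds of terms of the theorem become counts Ins (∂_a ∘ ν), Del (ν ∘ ∂_a)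
-- and Θ (θ ∘ ν ∘ ∂), and everything rests on the insertion identity
-- Ins = Del + Θ (Arrangements), proved by induction on u through a
-- double-sum exchange that uses that of two distinct labels exactly one is
-- the smaller.

module Sums where

  open import Data.Nat using (ℕ; zero; suc; _+_; _*_)
  open import Data.Nat.Properties
  open import Data.Fin using (Fin) renaming (zero to fz; suc to fs)
  open import Data.List using (List; []; _∷_; _++_; map; concatMap; allFin; filterᵇ; tabulate)
  open import Data.List.Relation.Unary.All using (All; []; _∷_)
  open import Data.Bool using (Bool; true; false; if_then_else_; _∧_)
  open import Relation.Binary.PropositionalEquality
  open import Data.Nat.Tactic.RingSolver

  when : Bool → ℕ → ℕ
  when true n = n
  when false n = 0

  when-+ : ∀ c m n → when c (m + n) ≡ when c m + when c n
  when-+ true m n = refl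
  when-+ false m n = refl

  when-* : ∀ c k n → when c (k * n) ≡ k * when c n
  when-* true k n = refl
  when-* false k n = sym (*-zeroʳ k)

  when-0 : ∀ c → when c 0 ≡ 0
  when-0 true = refl
  when-0 false = refl

  when-comm : ∀ c d n → when c (when d n) ≡ when d (when c n)
  when-comm true d n = refl
  when-comm false true n = refl
  when-comm false false n = refl

  when-∧ : ∀ c d n → when (c ∧ d) n ≡ when c (when d n)
  when-∧ true d n = refl
  when-∧ false d n = refl

  if-when : ∀ c n → (if c then n else 0) ≡ when c n
  if-when true n = refl
  if-when false n = refl

  +-interchange : ∀ a b c d → a + b + (c + d) ≡ a + c + (b + d)
  +-interchange = solve-∀

  ΣF : ∀ n → (Fin n → ℕ) → ℕ
  ΣF zero f = 0
  ΣF (suc n) f = f fz + ΣF n (λ i → f (fs i))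

  ΣF-cong : ∀ n {f g : Fin n → ℕ} → (∀ i → f i ≡ g i) → ΣF n f ≡ ΣF n g
  ΣF-cong zero e = refl
  ΣF-cong (suc n) e = cong₂ _+_ (e fz) (ΣF-cong n (λ i → e (fs i)))

  ΣF-+ : ∀ n (f g : Fin n → ℕ) → ΣF n (λ i → f i + g i) ≡ ΣF n f + ΣF n g
  ΣF-+ zero f g = refl
  ΣF-+ (suc n) f g = trans (cong (f fz + g fz +_) (ΣF-+ n _ _)) (+-interchange (f fz) (g fz) _ _)

  ΣF-when : ∀ n c (f : Fin n → ℕ) → ΣF n (λ i → when c (f i)) ≡ when c (ΣF n f)
  ΣF-when n true f = refl
  ΣF-when zero false f = refl
  ΣF-when (suc n) false f = ΣF-when n false (λ i → f (fs i))

  ΣF-0 : ∀ n → ΣF n (λ _ → 0) ≡ 0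
  ΣF-0 zero = refl
  ΣF-0 (suc n) = ΣF-0 n

  ΣF-* : ∀ n k (f : Fin n → ℕ) → ΣF n (λ i → k * f i) ≡ k * ΣF n f
  ΣF-* zero k f = sym (*-zeroʳ k)
  ΣF-* (suc n) k f = trans (cong (k * f fz +_) (ΣF-* n k _)) (sym (*-distribˡ-+ k (f fz) _))

  ΣF-swap : ∀ n m (f : Fin n → Fin m → ℕ) → ΣF n (λ i → ΣF m (λ j → f i j)) ≡ ΣF m (λ j → ΣF n (λ i → f i j))
  ΣF-swap zero m f = sym (ΣF-0 m)
  ΣF-swap (suc n) m f = trans (cong (ΣF m (f fz) +_) (ΣF-swap n m _)) (sym (ΣF-+ m _ _))

  sumN : ∀ {A : Set} → List A → (A → ℕ) → ℕ
  sumN [] f = 0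
  sumN (x ∷ xs) f = f x + sumN xs f

  sumN-tabulate : ∀ {A : Set} n (g : Fin n → A) (f : A → ℕ) → sumN (tabulate g) f ≡ ΣF n (λ i → f (g i))
  sumN-tabulate zero g f = refl
  sumN-tabulate (suc n) g f = cong (f (g fz) +_) (sumN-tabulate n (λ i → g (fs i)) f)

  sumN-allFin : ∀ n (f : Fin n → ℕ) → sumN (allFin n) f ≡ ΣF n f
  sumN-allFin n f = sumN-tabulate n (λ i → i) f

  sumN-++ : ∀ {A : Set} (xs ys : List A) f → sumN (xs ++ ys) f ≡ sumN xs f + sumN ys f
  sumN-++ [] ys f = refl
  sumN-++ (x ∷ xs) ys f = trans (cong (f x +_) (sumN-++ xs ys f)) (sym (+-assoc (f x) _ _))

  sumN-map : ∀ {A B : Set} (g : A → B) (xs : List A) f → sumN (map g xs) f ≡ sumN xs (λ x → f (g x))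
  sumN-map g [] f = refl
  sumN-map g (x ∷ xs) f = cong (f (g x) +_) (sumN-map g xs f)

  sumN-concatMap : ∀ {A B : Set} (g : A → List B) (xs : List A) f → sumN (concatMap g xs) f ≡ sumN xs (λ x → sumN (g x) f)
  sumN-concatMap g [] f = refl
  sumN-concatMap g (x ∷ xs) f = trans (sumN-++ (g x) (concatMap g xs) f) (cong (sumN (g x) f +_) (sumN-concatMap g xs f))

  sumN-cong : ∀ {A : Set} (xs : List A) {f g : A → ℕ} → (∀ x → f x ≡ g x) → sumN xs f ≡ sumN xs g
  sumN-cong [] e = refl
  sumN-cong (x ∷ xs) e = cong₂ _+_ (e x) (sumN-cong xs e)

  sumN-congAll : ∀ {A : Set} (xs : List A) {f g : A → ℕ} → All (λ x → f x ≡ g x) xs → sumN xs f ≡ sumN xs g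
  sumN-congAll [] [] = refl
  sumN-congAll (x ∷ xs) (e ∷ es) = cong₂ _+_ e (sumN-congAll xs es)

  sumN-+ : ∀ {A : Set} (xs : List A) (f g : A → ℕ) → sumN xs (λ x → f x + g x) ≡ sumN xs f + sumN xs g
  sumN-+ [] f g = refl
  sumN-+ (x ∷ xs) f g = trans (cong (f x + g x +_) (sumN-+ xs f g)) (+-interchange (f x) (g x) _ _)

  sumN-when : ∀ {A : Set} (xs : List A) c (f : A → ℕ) → sumN xs (λ x → when c (f x)) ≡ when c (sumN xs f)
  sumN-when xs true f = refl
  sumN-when [] false f = refl
  sumN-when (x ∷ xs) false f = sumN-when xs false f

  sumN-0 : ∀ {A : Set} (xs : List A) → sumN xs (λ _ → 0) ≡ 0
  sumN-0 [] = refl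
  sumN-0 (x ∷ xs) = sumN-0 xs

  sumN-ΣF : ∀ {A : Set} (xs : List A) n (f : A → Fin n → ℕ) → sumN xs (λ x → ΣF n (f x)) ≡ ΣF n (λ q → sumN xs (λ x → f x q))
  sumN-ΣF [] n f = sym (ΣF-0 n)
  sumN-ΣF (x ∷ xs) n f = trans (cong (ΣF n (f x) +_) (sumN-ΣF xs n f)) (sym (ΣF-+ n (f x) (λ q → sumN xs (λ x → f x q))))

  filter-true : ∀ {A : Set} (q : A → Bool) z zs → q z ≡ true → filterᵇ q (z ∷ zs) ≡ z ∷ filterᵇ q zs
  filter-true q z zs e with q z
  ... | true = refl

  filter-false : ∀ {A : Set} (q : A → Bool) z zs → q z ≡ false → filterᵇ q (z ∷ zs) ≡ filterᵇ q zs
  filter-false q z zs e with q z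
  ... | false = refl

  filter-congAll : ∀ {A : Set} (q q' : A → Bool) (zs : List A) → All (λ y → q y ≡ q' y) zs → filterᵇ q zs ≡ filterᵇ q' zs
  filter-congAll q q' [] [] = refl
  filter-congAll q q' (z ∷ zs) (e ∷ es) = by-test (q z) refl
    where
    by-test : ∀ b → q z ≡ b → filterᵇ q (z ∷ zs) ≡ filterᵇ q' (z ∷ zs)
    by-test true eq = trans (filter-true q z zs eq) (sym (trans (filter-true q' z zs (trans (sym e) eq)) (cong (z ∷_) (sym (filter-congAll q q' zs es)))))
    by-test false eq = trans (filter-false q z zs eq) (sym (trans (filter-false q' z zs (trans (sym e) eq)) (sym (filter-congAll q q' zs es))))

  filter-id : ∀ {A : Set} (zs : List A) → filterᵇ (λ _ → true) zs ≡ zs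
  filter-id [] = refl
  filter-id (z ∷ zs) = cong (z ∷_) (filter-id zs)

  sumN-filter : ∀ {A : Set} (p : A → Bool) (xs : List A) f → sumN (filterᵇ p xs) f ≡ sumN xs (λ x → when (p x) (f x))
  sumN-filter p [] f = refl
  sumN-filter p (x ∷ xs) f = by-test (p x) refl
    where
    by-test : ∀ b → p x ≡ b → sumN (filterᵇ p (x ∷ xs)) f ≡ sumN (x ∷ xs) (λ x → when (p x) (f x))
    by-test true eq rewrite filter-true p x xs eq | eq = cong (f x +_) (sumN-filter p xs f)
    by-test false eq rewrite filter-false p x xs eq | eq = sumN-filter p xs f


module LetterTests where

  open import Defs
  open import Data.Nat using (_<_; _<ᵇ_)
  open import Data.Nat.Properties using (<⇒<ᵇ; <ᵇ⇒<)
  open import Data.Fin using (Fin) renaming (suc to fs)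
  open import Data.Fin.Properties using () renaming (_≟_ to _≟F_)
  open import Data.Bool using (true; false)
  open import Data.Bool.Properties using (T-≡)
  open import Data.Empty using (⊥-elim)
  open import Function.Bundles using (Equivalence)
  open import Relation.Nullary using (¬_; yes; no)
  open import Relation.Binary.PropositionalEquality

  <→ᵇ : ∀ {x y} → x < y → (x <ᵇ y) ≡ true
  <→ᵇ x<y = Equivalence.to T-≡ (<⇒<ᵇ x<y)

  ≮→ᵇ : ∀ {x y} → ¬ (x < y) → (x <ᵇ y) ≡ false
  ≮→ᵇ {x} {y} x≮y with x <ᵇ y in eq
  ... | false = refl
  ... | true = ⊥-elim (x≮y (<ᵇ⇒< x y (Equivalence.from T-≡ eq)))

  <ᵇ→ : ∀ x y → (x <ᵇ y) ≡ true → x < y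
  <ᵇ→ x y e = <ᵇ⇒< x y (Equivalence.from T-≡ e)

  eqF-yes : ∀ {s} {x y : Fin s} → x ≡ y → eqF x y ≡ true
  eqF-yes {x = x} {y} e with x ≟F y
  ... | yes _ = refl
  ... | no ne = ⊥-elim (ne e)

  eqF-no : ∀ {s} {x y : Fin s} → ¬ x ≡ y → eqF x y ≡ false
  eqF-no {x = x} {y} ne with x ≟F y
  ... | yes e = ⊥-elim (ne e)
  ... | no _ = refl

  eqF-refl : ∀ {s} (x : Fin s) → eqF x x ≡ true
  eqF-refl x = eqF-yes refl

  eqF→≡ : ∀ {s} (x y : Fin s) → eqF x y ≡ true → x ≡ y
  eqF→≡ x y e with x ≟F y
  ... | yes p = p

  eqF-suc : ∀ {s} (c b : Fin s) → eqF (fs c) (fs b) ≡ eqF c b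
  eqF-suc c b with c ≟F b
  ... | yes refl = refl
  ... | no ne = refl

  eqF-sym : ∀ {s} (i j : Fin s) → eqF i j ≡ eqF j i
  eqF-sym i j with i ≟F j | j ≟F i
  ... | yes _ | yes _ = refl
  ... | no _  | no _  = refl
  ... | yes p | no q  = ⊥-elim (q (sym p))
  ... | no p  | yes q = ⊥-elim (p (sym q))


-- Sums over "picking one element" of a list: Σpick X f adds f x R over all
-- ways of removing one entry x from X, R being the list of the others.
-- Arrangements of tiles are built by repeatedly picking the next tile.
module Picking where

  open import Data.Nat using (ℕ; _+_; _*_)
  open import Data.Nat.Properties using (*-zeroʳ; *-distribˡ-+)
  open import Data.Fin using (Fin)
  open import Data.List using (List; []; _∷_)
  open import Data.Bool using (true; false)
  open import Data.List.Relation.Unary.All using (All; []; _∷_)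
  open import Data.Product using (_×_; _,_)
  open import Relation.Binary.PropositionalEquality
  open import Data.Nat.Tactic.RingSolver
  open Sums

  module _ {A : Set} where

    Σpick : List A → (A → List A → ℕ) → ℕ
    Σpick [] f = 0
    Σpick (z ∷ X) f = f z X + Σpick X (λ x R → f x (z ∷ R))

    data Pick : List A → A → List A → Set where
      here : ∀ {z X} → Pick (z ∷ X) z X
      there : ∀ {z X x R} → Pick X x R → Pick (z ∷ X) x (z ∷ R)

    All-pick : ∀ {P : A → Set} {X x R} → All P X → Pick X x R → P x × All P R
    All-pick (p ∷ ps) here = p , ps
    All-pick (p ∷ ps) (there sl) with All-pick ps sl
    ... | q , qs = q , (p ∷ qs)

    Σpick-congPick : ∀ X {f g : A → List A → ℕ} → (∀ {x R} → Pick X x R → f x R ≡ g x R) → Σpick X f ≡ Σpick X g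
    Σpick-congPick [] e = refl
    Σpick-congPick (z ∷ X) e = cong₂ _+_ (e here) (Σpick-congPick X (λ sl → e (there sl)))

    Σpick-cong : ∀ X {f g : A → List A → ℕ} → (∀ x R → f x R ≡ g x R) → Σpick X f ≡ Σpick X g
    Σpick-cong X e = Σpick-congPick X (λ {x} {R} _ → e x R)

    Σpick-+ : ∀ X (f g : A → List A → ℕ) → Σpick X (λ x R → f x R + g x R) ≡ Σpick X f + Σpick X g
    Σpick-+ [] f g = refl
    Σpick-+ (z ∷ X) f g = trans (cong (f z X + g z X +_) (Σpick-+ X _ _)) (+-interchange (f z X) (g z X) _ _)

    Σpick-when : ∀ X c (f : A → List A → ℕ) → Σpick X (λ x R → when c (f x R)) ≡ when c (Σpick X f)
    Σpick-when X true f = refl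
    Σpick-when [] false f = refl
    Σpick-when (z ∷ X) false f = Σpick-when X false (λ x R → f x (z ∷ R))

    Σpick-0 : ∀ X → Σpick X (λ _ _ → 0) ≡ 0
    Σpick-0 [] = refl
    Σpick-0 (z ∷ X) = Σpick-0 X

    Σpick-* : ∀ X k (f : A → List A → ℕ) → Σpick X (λ x R → k * f x R) ≡ k * Σpick X f
    Σpick-* [] k f = sym (*-zeroʳ k)
    Σpick-* (z ∷ X) k f = trans (cong (k * f z X +_) (Σpick-* X k _)) (sym (*-distribˡ-+ k (f z X) _))

    Σpick-ΣF : ∀ X n (f : A → List A → Fin n → ℕ) → Σpick X (λ x R → ΣF n (λ q → f x R q)) ≡ ΣF n (λ q → Σpick X (λ x R → f x R q))
    Σpick-ΣF [] n f = sym (ΣF-0 n)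
    Σpick-ΣF (z ∷ X) n f = trans (cong (ΣF n (f z X) +_) (Σpick-ΣF X n _)) (sym (ΣF-+ n _ _))

    Σpick-swap : ∀ X (F : A → A → List A → ℕ) →
      Σpick X (λ x R → Σpick R (λ y R' → F x y R')) ≡ Σpick X (λ y R → Σpick R (λ x R' → F x y R'))
    Σpick-swap [] F = refl
    Σpick-swap (z ∷ X) F = begin
        Σpick X (λ y R' → F z y R') + Σpick X (λ x R → F x z R + Σpick R (λ y R' → F x y (z ∷ R')))
      ≡⟨ cong (Σpick X (λ y R' → F z y R') +_) (Σpick-+ X _ _) ⟩
        Σpick X (λ y R' → F z y R') + (Σpick X (λ x R → F x z R) + Σpick X (λ x R → Σpick R (λ y R' → F x y (z ∷ R'))))
      ≡⟨ cong (λ t → Σpick X (λ y R' → F z y R') + (Σpick X (λ x R → F x z R) + t)) (Σpick-swap X (λ x y R' → F x y (z ∷ R'))) ⟩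
        Σpick X (λ y R' → F z y R') + (Σpick X (λ x R → F x z R) + Σpick X (λ y R → Σpick R (λ x R' → F x y (z ∷ R'))))
      ≡⟨ +-left-comm (Σpick X (λ y R' → F z y R')) (Σpick X (λ x R → F x z R)) _ ⟩
        Σpick X (λ x R → F x z R) + (Σpick X (λ y R' → F z y R') + Σpick X (λ y R → Σpick R (λ x R' → F x y (z ∷ R'))))
      ≡⟨ cong (Σpick X (λ x R → F x z R) +_) (sym (Σpick-+ X _ _)) ⟩
        Σpick X (λ x R → F x z R) + Σpick X (λ y R → F z y R + Σpick R (λ x R' → F x y (z ∷ R')))
      ∎
      where
      open ≡-Reasoning
      +-left-comm : ∀ a b c → a + (b + c) ≡ b + (a + c)
      +-left-comm = solve-∀

    Σpick²-+ : ∀ X (F G : A → A → List A → ℕ) →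
      Σpick X (λ y R → Σpick R (F y)) + Σpick X (λ y R → Σpick R (G y)) ≡ Σpick X (λ y R → Σpick R (λ x R' → F y x R' + G y x R'))
    Σpick²-+ X F G = trans (sym (Σpick-+ X (λ y R → Σpick R (F y)) (λ y R → Σpick R (G y))))
                        (Σpick-cong X (λ y R → sym (Σpick-+ R (F y) (G y))))

    Σpick-pull : ∀ R c d (f g : A → List A → ℕ) → when c (Σpick R f + when d (Σpick R g)) ≡ Σpick R (λ y R' → when c (f y R' + when d (g y R')))
    Σpick-pull R c d f g = begin
        when c (Σpick R f + when d (Σpick R g))
      ≡⟨ cong (λ t → when c (Σpick R f + t)) (sym (Σpick-when R d g)) ⟩
        when c (Σpick R f + Σpick R (λ y R' → when d (g y R')))
      ≡⟨ cong (when c) (sym (Σpick-+ R f _)) ⟩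
        when c (Σpick R (λ y R' → f y R' + when d (g y R')))
      ≡⟨ sym (Σpick-when R c _) ⟩
        Σpick R (λ y R' → when c (f y R' + when d (g y R')))
      ∎ where open ≡-Reasoning

    Σpick-pull₂ : ∀ R c d k (f g : A → List A → ℕ) → when c (when d (Σpick R f) + k * Σpick R g) ≡ Σpick R (λ y R' → when c (when d (f y R') + k * g y R'))
    Σpick-pull₂ R c d k f g = begin
        when c (when d (Σpick R f) + k * Σpick R g)
      ≡⟨ cong₂ (λ t t' → when c (t + t')) (sym (Σpick-when R d f)) (sym (Σpick-* R k g)) ⟩
        when c (Σpick R (λ y R' → when d (f y R')) + Σpick R (λ y R' → k * g y R'))
      ≡⟨ cong (when c) (sym (Σpick-+ R _ _)) ⟩
        when c (Σpick R (λ y R' → when d (f y R') + k * g y R'))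
      ≡⟨ sym (Σpick-when R c _) ⟩
        Σpick R (λ y R' → when c (when d (f y R') + k * g y R'))
      ∎ where open ≡-Reasoning

module Arrangements where

  open import Defs
  open Sums
  open LetterTests
  open Picking

  open import Data.Nat using (ℕ; zero; suc; _+_; _*_; _<ᵇ_; _<_)
  open import Data.Nat.Properties
  open import Relation.Binary.Definitions using (tri<; tri≈; tri>)
  open import Data.Fin using (Fin)
  open import Data.Vec using (Vec; []; _∷_; lookup; insertAt; updateAt)
  open import Data.List using (List; []; _∷_)
  open import Data.List.Relation.Unary.All using (All; []; _∷_)
  open import Data.List.Relation.Unary.AllPairs using (AllPairs; []; _∷_)
  open import Data.Product using (_×_; _,_; proj₁; proj₂)
  open import Data.Bool using (Bool; true; false)
  open import Data.Maybe using (Maybe; just; nothing)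
  open import Data.Empty using (⊥-elim)
  open import Relation.Nullary using (¬_)
  open import Relation.Binary.PropositionalEquality
  open import Data.Nat.Tactic.RingSolver

  when-absorb : ∀ c d Z → (c ≡ true → d ≡ true) → when c Z ≡ when c (when d Z)
  when-absorb true d Z c⇒d rewrite c⇒d refl = refl
  when-absorb false d Z c⇒d = refl

  above-mono : ∀ b {x y} → x < y → above b x ≡ true → above b y ≡ true
  above-mono nothing x<y _ = refl
  above-mono (just β) {x} x<y β<x = <→ᵇ (<-trans (<ᵇ→ β x β<x) x<y)

  label-order-split : ∀ b x y Z → ¬ (x ≡ y) →
    when (above b x) (when (x <ᵇ y) Z) + when (above b y) (when (y <ᵇ x) Z) ≡ when (above b x) (when (above b y) Z)
  label-order-split b x y Z x≢y with <-cmp x y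
  ... | tri≈ _ x≡y _ = ⊥-elim (x≢y x≡y)
  ... | tri< x<y _ y≮x rewrite <→ᵇ x<y | ≮→ᵇ y≮x | when-0 (above b y) =
    trans (+-identityʳ _) (when-absorb (above b x) (above b y) Z (above-mono b x<y))
  ... | tri> x≮y _ y<x rewrite <→ᵇ y<x | ≮→ᵇ x≮y | when-0 (above b x) =
    trans (when-absorb (above b y) (above b x) Z (above-mono b y<x)) (when-comm (above b y) (above b x) Z)

  module _ {s : ℕ} where

    -- A tile is a letter carrying a numeric label (its position in w).
    Tile : Set
    Tile = ℕ × Fin s

    DistinctLabels : List Tile → Set
    DistinctLabels = AllPairs (λ x y → ¬ (proj₁ x ≡ proj₁ y))

    DistinctLabels-pick : ∀ {X x R} → DistinctLabels X → Pick X x R → DistinctLabels R × All (λ y → ¬ (proj₁ x ≡ proj₁ y)) R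
    DistinctLabels-pick (ps ∷ d) here = d , ps
    DistinctLabels-pick (ps ∷ d) (there sl) with DistinctLabels-pick d sl | All-pick ps sl
    ... | dR , aR | q , qs = (qs ∷ dR) , ((λ e → q (sym e)) ∷ aR)

    Σpick²-congDistinct : ∀ X → DistinctLabels X → (F G : Tile → Tile → List Tile → ℕ) → (∀ y x R' → ¬ (proj₁ x ≡ proj₁ y) → F y x R' ≡ G y x R') →
      Σpick X (λ y R → Σpick R (F y)) ≡ Σpick X (λ y R → Σpick R (G y))
    Σpick²-congDistinct X d F G e = Σpick-congPick X (λ {y} {R} sl → Σpick-congPick R (λ {x} {R'} sl' →
      e y x R' (λ x≡y → proj₁ (All-pick (proj₂ (DistinctLabels-pick d sl)) sl') (sym x≡y))))

    Σpick-exchange : ∀ X → DistinctLabels X → (F1 F2 F3 F4 : Tile → Tile → List Tile → ℕ) →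
      (∀ x y R' → ¬ (proj₁ x ≡ proj₁ y) → F1 x y R' + F2 x y R' ≡ F3 x y R' + F4 x y R') →
      Σpick X (λ x R → Σpick R (F1 x)) + Σpick X (λ y R → Σpick R (λ x R' → F2 x y R'))
        ≡ Σpick X (λ x R → Σpick R (F3 x)) + Σpick X (λ y R → Σpick R (λ x R' → F4 x y R'))
    Σpick-exchange X d F1 F2 F3 F4 pointwise = begin
        Σpick X (λ x R → Σpick R (F1 x)) + Σpick X (λ y R → Σpick R (λ x R' → F2 x y R'))
      ≡⟨ cong (_+ Σpick X (λ y R → Σpick R (λ x R' → F2 x y R'))) (Σpick-swap X F1) ⟩
        Σpick X (λ y R → Σpick R (λ x R' → F1 x y R')) + Σpick X (λ y R → Σpick R (λ x R' → F2 x y R'))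
      ≡⟨ Σpick²-+ X (λ y x R' → F1 x y R') (λ y x R' → F2 x y R') ⟩
        Σpick X (λ y R → Σpick R (λ x R' → F1 x y R' + F2 x y R'))
      ≡⟨ Σpick²-congDistinct X d _ _ (λ y x R' ne → pointwise x y R' ne) ⟩
        Σpick X (λ y R → Σpick R (λ x R' → F3 x y R' + F4 x y R'))
      ≡⟨ sym (Σpick²-+ X (λ y x R' → F3 x y R') (λ y x R' → F4 x y R')) ⟩
        Σpick X (λ y R → Σpick R (λ x R' → F3 x y R')) + Σpick X (λ y R → Σpick R (λ x R' → F4 x y R'))
      ≡⟨ cong (_+ Σpick X (λ y R → Σpick R (λ x R' → F4 x y R'))) (sym (Σpick-swap X F3)) ⟩
        Σpick X (λ x R → Σpick R (F3 x)) + Σpick X (λ y R → Σpick R (λ x R' → F4 x y R'))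
      ∎ where open ≡-Reasoning

    -- A count of tile arrangements, depending on a lower bound b for the
    -- labels, the length L of the increasing label sequences, the available
    -- tiles and the word to be spelled.
    Count : Set
    Count = ∀ {r} → Maybe ℕ → ℕ → List Tile → Vec (Fin s) r → ℕ

    isZero : ℕ → ℕ
    isZero zero = 1
    isZero (suc _) = 0

    -- Arr b L X u: number of pairs (σ, S) where σ is a sequence of distinct
    -- tiles of X spelling u and S is an increasing sequence of L labels of σ
    -- (in the order of σ), all above b.  The first tile of σ is either
    -- outside S or is its first element.
    Arr : Count
    Arr b L X [] = isZero L
    Arr b zero X (c ∷ u) = Σpick X (λ x R → when (eqF (proj₂ x) c) (Arr b zero R u + 0))
    Arr b (suc l) X (c ∷ u) = Σpick X (λ x R → when (eqF (proj₂ x) c) (Arr b (suc l) R u + when (above b (proj₁ x)) (Arr (just (proj₁ x)) l R u)))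

    -- Contribution of S starting at the tile x (the bound becomes x's label).
    startTerm : Count → ∀ {r} → Maybe ℕ → ℕ → Tile → List Tile → Vec (Fin s) r → ℕ
    startTerm B b zero x R u = 0
    startTerm B b (suc l) x R u = when (above b (proj₁ x)) (B (just (proj₁ x)) l R u)

    -- Contribution of a tile x above b that is removed together with one
    -- element of S (the bound stays b).
    skipTerm : Count → ∀ {r} → Maybe ℕ → ℕ → Tile → List Tile → Vec (Fin s) r → ℕ
    skipTerm B b zero x R u = 0
    skipTerm B b (suc l) x R u = when (above b (proj₁ x)) (B b l R u)

    Arr-cons : ∀ {r} b L X c (u : Vec (Fin s) r) → Arr b L X (c ∷ u) ≡ Σpick X (λ x R → when (eqF (proj₂ x) c) (Arr b L R u + startTerm Arr b L x R u))
    Arr-cons b zero X c u = refl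
    Arr-cons b (suc l) X c u = refl

    -- The two orders of choosing start points of S, for tiles x ≠ y.
    startTerm-split : ∀ {r} b l x y R' (u : Vec (Fin s) r) → ¬ (proj₁ x ≡ proj₁ y) →
      when (above b (proj₁ x)) (startTerm Arr (just (proj₁ x)) l y R' u) + when (above b (proj₁ y)) (skipTerm Arr (just (proj₁ y)) l x R' u)
        ≡ when (above b (proj₁ x)) (startTerm Arr b l y R' u)
    startTerm-split b zero x y R' u ne rewrite when-0 (above b (proj₁ x)) | when-0 (above b (proj₁ y)) = refl
    startTerm-split b (suc m) x y R' u ne = label-order-split b (proj₁ x) (proj₁ y) (Arr (just (proj₁ y)) m R' u) ne

    -- The three counts of the theorem for a fixed letter a:
    --   Ins  inserts a into u in every position (the coefficient of ∂_a ∘ ν),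
    --   Del  removes a tile carrying a (ν ∘ ∂_a, with the weight of the
    --        deleted letter), and
    --   Θ    removes a tile x and turns an occurrence of x's letter in u into a
    --        (the θ-terms).
    module FixedLetter (a : Fin s) where
      setA : ∀ {r} → Vec (Fin s) r → Fin r → Vec (Fin s) r
      setA u q = updateAt u q (λ _ → a)

      Ins : Count
      Ins {r} b L X u = ΣF (suc r) (λ p → Arr b L X (insertAt u p a))

      Θ : Count
      Θ {r} b L X u = Σpick X (λ x R → ΣF r (λ q → when (eqF (lookup u q) (proj₂ x)) (Arr b L R (setA u q))))

      Del : Count
      Del b L X u = Σpick X (λ x R → when (eqF (proj₂ x) a) (skipTerm Arr b L x R u + suc L * Arr b L R u))

      startTerm-ΣF : ∀ {r} b L y R (u : Vec (Fin s) r) → ΣF (suc r) (λ p → startTerm Arr b L y R (insertAt u p a)) ≡ startTerm Ins b L y R u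
      startTerm-ΣF {r} b zero y R u = ΣF-0 (suc r)
      startTerm-ΣF {r} b (suc l) y R u = ΣF-when (suc r) (above b (proj₁ y)) (λ p → Arr (just (proj₁ y)) l R (insertAt u p a))

      Θ-startTerm : ∀ {r} b L y R (u : Vec (Fin s) r) →
        Σpick R (λ x R' → ΣF r (λ q → when (eqF (lookup u q) (proj₂ x)) (startTerm Arr b L y R' (setA u q)))) ≡ startTerm Θ b L y R u
      Θ-startTerm {r} b zero y R u = trans (Σpick-cong R (λ x R' → trans (ΣF-cong r (λ q → when-0 (eqF (lookup u q) (proj₂ x)))) (ΣF-0 r))) (Σpick-0 R)
      Θ-startTerm {r} b (suc l) y R u = trans (Σpick-cong R (λ x R' → trans (ΣF-cong r (λ q → when-comm (eqF (lookup u q) (proj₂ x)) (above b (proj₁ y)) _))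
                                                                  (ΣF-when r (above b (proj₁ y)) _)))
                                     (Σpick-when R (above b (proj₁ y)) _)

      -- Expanding the first letter c of the word.  For Ins, either a is
      -- inserted in front, or the first tile spells c and a goes into the rest.
      Ins-cons : ∀ {r} b L X c (u : Vec (Fin s) r) →
        Ins b L X (c ∷ u) ≡ Arr b L X (a ∷ c ∷ u) + Σpick X (λ y R → when (eqF (proj₂ y) c) (Ins b L R u + startTerm Ins b L y R u))
      Ins-cons {r} b L X c u = cong (Arr b L X (a ∷ c ∷ u) +_) (begin
          ΣF (suc r) (λ p → Arr b L X (c ∷ insertAt u p a))
        ≡⟨ ΣF-cong (suc r) (λ p → Arr-cons b L X c (insertAt u p a)) ⟩
          ΣF (suc r) (λ p → Σpick X (λ y R → when (eqF (proj₂ y) c) (Arr b L R (insertAt u p a) + startTerm Arr b L y R (insertAt u p a))))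
        ≡⟨ sym (Σpick-ΣF X (suc r) (λ y R p → when (eqF (proj₂ y) c) (Arr b L R (insertAt u p a) + startTerm Arr b L y R (insertAt u p a)))) ⟩
          Σpick X (λ y R → ΣF (suc r) (λ p → when (eqF (proj₂ y) c) (Arr b L R (insertAt u p a) + startTerm Arr b L y R (insertAt u p a))))
        ≡⟨ Σpick-cong X (λ y R → trans (ΣF-when (suc r) (eqF (proj₂ y) c) (λ p → Arr b L R (insertAt u p a) + startTerm Arr b L y R (insertAt u p a)))
                                    (cong (when (eqF (proj₂ y) c)) (trans (ΣF-+ (suc r) (λ p → Arr b L R (insertAt u p a)) (λ p → startTerm Arr b L y R (insertAt u p a))) (cong (Ins b L R u +_) (startTerm-ΣF b L y R u))))) ⟩
          Σpick X (λ y R → when (eqF (proj₂ y) c) (Ins b L R u + startTerm Ins b L y R u))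
        ∎)
        where open ≡-Reasoning

      -- For Θ, either the replaced position is the first one (then u starts
      -- with a), or the first tile spells c.
      Θ-cons : ∀ {r} b L X c (u : Vec (Fin s) r) →
        Θ b L X (c ∷ u) ≡ Σpick X (λ x R → when (eqF c (proj₂ x)) (Arr b L R (a ∷ u)))
                          + Σpick X (λ y R → when (eqF (proj₂ y) c) (Θ b L R u + startTerm Θ b L y R u))
      Θ-cons {r} b L X c u = begin
          Σpick X (λ x R → when (eqF c (proj₂ x)) (Arr b L R (a ∷ u)) + ΣF r (λ q → when (eqF (lookup u q) (proj₂ x)) (Arr b L R (c ∷ setA u q))))
        ≡⟨ Σpick-+ X _ _ ⟩
          Σpick X (λ x R → when (eqF c (proj₂ x)) (Arr b L R (a ∷ u))) + Σpick X (λ x R → ΣF r (λ q → when (eqF (lookup u q) (proj₂ x)) (Arr b L R (c ∷ setA u q))))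
        ≡⟨ cong (Σpick X (λ x R → when (eqF c (proj₂ x)) (Arr b L R (a ∷ u))) +_) replace-later ⟩
          Σpick X (λ x R → when (eqF c (proj₂ x)) (Arr b L R (a ∷ u))) + Σpick X (λ y R → when (eqF (proj₂ y) c) (Θ b L R u + startTerm Θ b L y R u))
        ∎
        where
        open ≡-Reasoning
        -- x is the removed tile, y the first tile of the arrangement.
        G : Tile → Tile → List Tile → ℕ
        G x y R' = ΣF r (λ q → when (eqF (lookup u q) (proj₂ x)) (when (eqF (proj₂ y) c) (Arr b L R' (setA u q) + startTerm Arr b L y R' (setA u q))))
        replace-later : Σpick X (λ x R → ΣF r (λ q → when (eqF (lookup u q) (proj₂ x)) (Arr b L R (c ∷ setA u q))))
                 ≡ Σpick X (λ y R → when (eqF (proj₂ y) c) (Θ b L R u + startTerm Θ b L y R u))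
        replace-later = begin
            Σpick X (λ x R → ΣF r (λ q → when (eqF (lookup u q) (proj₂ x)) (Arr b L R (c ∷ setA u q))))
          ≡⟨ Σpick-cong X (λ x R → trans (ΣF-cong r (λ q → trans (cong (when (eqF (lookup u q) (proj₂ x))) (Arr-cons b L R c (setA u q)))
                                                                 (sym (Σpick-when R (eqF (lookup u q) (proj₂ x)) _))))
                                       (sym (Σpick-ΣF R r _))) ⟩
            Σpick X (λ x R → Σpick R (λ y R' → G x y R'))
          ≡⟨ Σpick-swap X G ⟩
            Σpick X (λ y R → Σpick R (λ x R' → G x y R'))
          ≡⟨ Σpick-cong X (λ y R → first-tile y R) ⟩
            Σpick X (λ y R → when (eqF (proj₂ y) c) (Θ b L R u + startTerm Θ b L y R u))
          ∎
          where
          first-tile : ∀ y R → Σpick R (λ x R' → G x y R') ≡ when (eqF (proj₂ y) c) (Θ b L R u + startTerm Θ b L y R u)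
          first-tile y R = begin
              Σpick R (λ x R' → G x y R')
            ≡⟨ Σpick-cong R (λ x R' → trans (ΣF-cong r (λ q → when-comm (eqF (lookup u q) (proj₂ x)) (eqF (proj₂ y) c) _)) (ΣF-when r (eqF (proj₂ y) c) _)) ⟩
              Σpick R (λ x R' → when (eqF (proj₂ y) c) (ΣF r (λ q → when (eqF (lookup u q) (proj₂ x)) (Arr b L R' (setA u q) + startTerm Arr b L y R' (setA u q)))))
            ≡⟨ Σpick-when R (eqF (proj₂ y) c) _ ⟩
              when (eqF (proj₂ y) c) (Σpick R (λ x R' → ΣF r (λ q → when (eqF (lookup u q) (proj₂ x)) (Arr b L R' (setA u q) + startTerm Arr b L y R' (setA u q)))))
            ≡⟨ cong (when (eqF (proj₂ y) c)) (trans (Σpick-cong R (λ x R' → trans (ΣF-cong r (λ q → when-+ (eqF (lookup u q) (proj₂ x)) _ _)) (ΣF-+ r _ _)))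
                                                (trans (Σpick-+ R _ _) (cong (Θ b L R u +_) (Θ-startTerm b L y R u)))) ⟩
              when (eqF (proj₂ y) c) (Θ b L R u + startTerm Θ b L y R u)
            ∎

      insertion-hyp : ∀ {r} (u : Vec (Fin s) r) → (∀ b L R → DistinctLabels R → Ins b L R u ≡ Del b L R u + Θ b L R u) →
        ∀ b L y R → DistinctLabels R → Ins b L R u + startTerm Ins b L y R u ≡ (Del b L R u + startTerm Del b L y R u) + (Θ b L R u + startTerm Θ b L y R u)
      insertion-hyp u IH b zero y R d = trans (cong (_+ 0) (IH b zero R d)) (+-interchange (Del b zero R u) (Θ b zero R u) 0 0)
      insertion-hyp u IH b (suc l) y R d =
        trans (cong₂ (λ t t' → t + when (above b (proj₁ y)) t') (IH b (suc l) R d) (IH (just (proj₁ y)) l R d))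
       (trans (cong ((Del b (suc l) R u + Θ b (suc l) R u) +_) (when-+ (above b (proj₁ y)) (Del (just (proj₁ y)) l R u) (Θ (just (proj₁ y)) l R u)))
              (+-interchange (Del b (suc l) R u) (Θ b (suc l) R u) _ _))

      -- The pointwise identity behind exchange-suc: a case distinction on the
      -- four tests (x carries a, y carries c, x above b, y above b), the
      -- last hypothesis being startTerm-split.
      exchange-arith : ∀ ea ec bx by (l e ey ex ebl t1 t2 t3 : ℕ) → when bx t1 + when by t2 ≡ when bx t3 →
          when ea (when ec (e + when by ey) + when bx (when ec (ex + t1)))
        + when ec (when ea (when bx ebl + suc (suc l) * e) + when by (when ea (t2 + suc l * ey)))
        ≡ when ea (when bx (when ec (ebl + t3)) + suc (suc l) * when ec (e + when by ey))
        + when ec (when ea (e + when bx ex))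
      exchange-arith false false bx by l e ey ex ebl t1 t2 t3 K = refl
      exchange-arith false true bx by l e ey ex ebl t1 t2 t3 K rewrite when-0 by = refl
      exchange-arith true false bx by l e ey ex ebl t1 t2 t3 K rewrite when-0 bx | *-zeroʳ (suc (suc l)) = refl
      exchange-arith true true true true l e ey ex ebl t1 t2 .(t1 + t2) refl = both-above l e ey ex ebl t1 t2
        where
        both-above : ∀ l e ey ex ebl t1 t2 → ((e + ey) + (ex + t1)) + ((ebl + suc (suc l) * e) + (t2 + suc l * ey))
                                           ≡ ((ebl + (t1 + t2)) + suc (suc l) * (e + ey)) + (e + ex)
        both-above = solve-∀
      exchange-arith true true true false l e ey ex ebl t1 t2 .(t1 + 0) refl = x-above l e ex ebl t1
        where
        x-above : ∀ l e ex ebl t1 → ((e + 0) + (ex + t1)) + ((ebl + suc (suc l) * e) + 0)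
                                   ≡ ((ebl + (t1 + 0)) + suc (suc l) * (e + 0)) + (e + ex)
        x-above = solve-∀
      exchange-arith true true false true l e ey ex ebl t1 .0 t3 refl = y-above l e ey
        where
        y-above : ∀ l e ey → ((e + ey) + 0) + ((0 + suc (suc l) * e) + (0 + suc l * ey))
                            ≡ (0 + suc (suc l) * (e + ey)) + (e + 0)
        y-above = solve-∀
      exchange-arith true true false false l e ey ex ebl t1 t2 t3 K = neither-above l e
        where
        neither-above : ∀ l e → ((e + 0) + 0) + ((0 + suc (suc l) * e) + 0) ≡ (0 + suc (suc l) * (e + 0)) + (e + 0)
        neither-above = solve-∀

      -- The exchange identity for L = l + 1: both sides are double pick sums
      -- over a tile x carrying a and a tile y carrying c.
      exchange-suc : ∀ {r} b l X c (u : Vec (Fin s) r) → DistinctLabels X →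
        Arr b (suc l) X (a ∷ c ∷ u) + Σpick X (λ y R → when (eqF (proj₂ y) c) (Del b (suc l) R u + startTerm Del b (suc l) y R u))
        ≡ Del b (suc l) X (c ∷ u) + Σpick X (λ y R → when (eqF c (proj₂ y)) (Arr b (suc l) R (a ∷ u)))
      exchange-suc b l X c u d = begin
          Arr b L' X (a ∷ c ∷ u) + Σpick X (λ y R → when (ec y) (Del b L' R u + startTerm Del b L' y R u))
        ≡⟨ cong₂ _+_ expand-Arr expand-Del-tail ⟩
          Σpick X (λ x R → Σpick R (arrTerm x)) + Σpick X (λ y R → Σpick R (λ x R' → delTailTerm x y R'))
        ≡⟨ Σpick-exchange X d arrTerm delTailTerm delTerm frontTerm pointwise ⟩
          Σpick X (λ x R → Σpick R (delTerm x)) + Σpick X (λ y R → Σpick R (λ x R' → frontTerm x y R'))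
        ≡⟨ cong₂ _+_ (sym expand-Del) (sym expand-front) ⟩
          Del b L' X (c ∷ u) + Σpick X (λ y R → when (eqF c (proj₂ y)) (Arr b L' R (a ∷ u)))
        ∎
        where
        open ≡-Reasoning
        L' = suc l
        ea : Tile → Bool
        ea x = eqF (proj₂ x) a
        ec : Tile → Bool
        ec y = eqF (proj₂ y) c
        bx : Tile → Bool
        bx x = above b (proj₁ x)
        f : Tile → List Tile → ℕ
        f y R' = when (ec y) (Arr b L' R' u + when (bx y) (Arr (just (proj₁ y)) l R' u))
        g : Tile → Tile → List Tile → ℕ
        g x y R' = when (ec y) (Arr (just (proj₁ x)) l R' u + startTerm Arr (just (proj₁ x)) l y R' u)
        arrTerm : Tile → Tile → List Tile → ℕ
        arrTerm x y R' = when (ea x) (f y R' + when (bx x) (g x y R'))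
        f' : Tile → List Tile → ℕ
        f' x R' = when (ea x) (skipTerm Arr b L' x R' u + suc L' * Arr b L' R' u)
        g' : Tile → Tile → List Tile → ℕ
        g' y x R' = when (ea x) (skipTerm Arr (just (proj₁ y)) l x R' u + suc l * Arr (just (proj₁ y)) l R' u)
        delTailTerm : Tile → Tile → List Tile → ℕ
        delTailTerm x y R' = when (ec y) (f' x R' + when (bx y) (g' y x R'))
        f3 : Tile → List Tile → ℕ
        f3 y R' = when (ec y) (Arr b l R' u + startTerm Arr b l y R' u)
        delTerm : Tile → Tile → List Tile → ℕ
        delTerm x y R' = when (ea x) (when (bx x) (f3 y R') + suc L' * f y R')
        frontTerm : Tile → Tile → List Tile → ℕ
        frontTerm x y R' = when (eqF c (proj₂ y)) (when (ea x) (Arr b L' R' u + when (bx x) (Arr (just (proj₁ x)) l R' u)))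
        expand-Arr : Arr b L' X (a ∷ c ∷ u) ≡ Σpick X (λ x R → Σpick R (arrTerm x))
        expand-Arr = Σpick-cong X (λ x R → trans (cong (λ t → when (ea x) (Arr b L' R (c ∷ u) + when (bx x) t)) (Arr-cons (just (proj₁ x)) l R c u))
                                              (Σpick-pull R (ea x) (bx x) f (g x)))
        expand-Del-tail : Σpick X (λ y R → when (ec y) (Del b L' R u + startTerm Del b L' y R u)) ≡ Σpick X (λ y R → Σpick R (λ x R' → delTailTerm x y R'))
        expand-Del-tail = Σpick-cong X (λ y R → Σpick-pull R (ec y) (bx y) f' (g' y))
        expand-Del : Del b L' X (c ∷ u) ≡ Σpick X (λ x R → Σpick R (delTerm x))
        expand-Del = Σpick-cong X (λ x R → trans (cong (λ t → when (ea x) (when (bx x) t + suc L' * Arr b L' R (c ∷ u))) (Arr-cons b l R c u))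
                                              (Σpick-pull₂ R (ea x) (bx x) (suc L') f3 f))
        expand-front : Σpick X (λ y R → when (eqF c (proj₂ y)) (Arr b L' R (a ∷ u))) ≡ Σpick X (λ y R → Σpick R (λ x R' → frontTerm x y R'))
        expand-front = Σpick-cong X (λ y R → sym (Σpick-when R (eqF c (proj₂ y)) _))
        pointwise : ∀ x y R' → ¬ (proj₁ x ≡ proj₁ y) → arrTerm x y R' + delTailTerm x y R' ≡ delTerm x y R' + frontTerm x y R'
        pointwise x y R' ne rewrite eqF-sym c (proj₂ y) =
          exchange-arith (ea x) (ec y) (bx x) (bx y) l (Arr b L' R' u) (Arr (just (proj₁ y)) l R' u) (Arr (just (proj₁ x)) l R' u) (Arr b l R' u)
                (startTerm Arr (just (proj₁ x)) l y R' u) (skipTerm Arr (just (proj₁ y)) l x R' u) (startTerm Arr b l y R' u)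
                (startTerm-split b l x y R' u ne)

      exchange-arith-zero : ∀ ea ec e → when ea (when ec (e + 0) + 0) + when ec (when ea (0 + 1 * e) + 0)
                                       ≡ when ea (0 + 1 * when ec (e + 0)) + when ec (when ea (e + 0))
      exchange-arith-zero false false e = refl
      exchange-arith-zero false true e = refl
      exchange-arith-zero true false e = refl
      exchange-arith-zero true true e = both e
        where
        both : ∀ e → (e + 0 + 0) + (0 + 1 * e + 0) ≡ (0 + 1 * (e + 0)) + (e + 0)
        both = solve-∀

      exchange-zero : ∀ {r} b X c (u : Vec (Fin s) r) → DistinctLabels X →
        Arr b zero X (a ∷ c ∷ u) + Σpick X (λ y R → when (eqF (proj₂ y) c) (Del b zero R u + startTerm Del b zero y R u))
        ≡ Del b zero X (c ∷ u) + Σpick X (λ y R → when (eqF c (proj₂ y)) (Arr b zero R (a ∷ u)))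
      exchange-zero b X c u d = begin
          Arr b zero X (a ∷ c ∷ u) + Σpick X (λ y R → when (ec y) (Del b zero R u + 0))
        ≡⟨ cong₂ _+_ expand-Arr expand-Del-tail ⟩
          Σpick X (λ x R → Σpick R (arrTerm x)) + Σpick X (λ y R → Σpick R (λ x R' → delTailTerm x y R'))
        ≡⟨ Σpick-exchange X d arrTerm delTailTerm delTerm frontTerm (λ x y R' _ → pointwise x y R') ⟩
          Σpick X (λ x R → Σpick R (delTerm x)) + Σpick X (λ y R → Σpick R (λ x R' → frontTerm x y R'))
        ≡⟨ cong₂ _+_ (sym expand-Del) (sym expand-front) ⟩
          Del b zero X (c ∷ u) + Σpick X (λ y R → when (eqF c (proj₂ y)) (Arr b zero R (a ∷ u)))
        ∎
        where
        open ≡-Reasoning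
        ea : Tile → Bool
        ea x = eqF (proj₂ x) a
        ec : Tile → Bool
        ec y = eqF (proj₂ y) c
        f : Tile → List Tile → ℕ
        f y R' = when (ec y) (Arr b zero R' u + 0)
        arrTerm : Tile → Tile → List Tile → ℕ
        arrTerm x y R' = when (ea x) (f y R' + when false (f y R'))
        f' : Tile → List Tile → ℕ
        f' x R' = when (ea x) (0 + 1 * Arr b zero R' u)
        delTailTerm : Tile → Tile → List Tile → ℕ
        delTailTerm x y R' = when (ec y) (f' x R' + when false (f' x R'))
        delTerm : Tile → Tile → List Tile → ℕ
        delTerm x y R' = when (ea x) (when false (f y R') + 1 * f y R')
        frontTerm : Tile → Tile → List Tile → ℕ
        frontTerm x y R' = when (eqF c (proj₂ y)) (when (ea x) (Arr b zero R' u + 0))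
        expand-Arr : Arr b zero X (a ∷ c ∷ u) ≡ Σpick X (λ x R → Σpick R (arrTerm x))
        expand-Arr = Σpick-cong X (λ x R → Σpick-pull R (ea x) false f f)
        expand-Del-tail : Σpick X (λ y R → when (ec y) (Del b zero R u + 0)) ≡ Σpick X (λ y R → Σpick R (λ x R' → delTailTerm x y R'))
        expand-Del-tail = Σpick-cong X (λ y R → Σpick-pull R (ec y) false f' f')
        expand-Del : Del b zero X (c ∷ u) ≡ Σpick X (λ x R → Σpick R (delTerm x))
        expand-Del = Σpick-cong X (λ x R → Σpick-pull₂ R (ea x) false 1 f f)
        expand-front : Σpick X (λ y R → when (eqF c (proj₂ y)) (Arr b zero R (a ∷ u))) ≡ Σpick X (λ y R → Σpick R (λ x R' → frontTerm x y R'))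
        expand-front = Σpick-cong X (λ y R → sym (Σpick-when R (eqF c (proj₂ y)) _))
        pointwise : ∀ x y R' → arrTerm x y R' + delTailTerm x y R' ≡ delTerm x y R' + frontTerm x y R'
        pointwise x y R' rewrite eqF-sym c (proj₂ y) = exchange-arith-zero (ea x) (ec y) (Arr b zero R' u)

      -- The exchange identity: the part of Ins(c ∷ u) with a in front, plus the
      -- Del-part of the recursive terms, equals Del(c ∷ u) plus the Θ-part
      -- that replaces the first letter c by a.
      exchange : ∀ {r} b L X c (u : Vec (Fin s) r) → DistinctLabels X →
        Arr b L X (a ∷ c ∷ u) + Σpick X (λ y R → when (eqF (proj₂ y) c) (Del b L R u + startTerm Del b L y R u))
        ≡ Del b L X (c ∷ u) + Σpick X (λ y R → when (eqF c (proj₂ y)) (Arr b L R (a ∷ u)))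
      exchange b zero X c u d = exchange-zero b X c u d
      exchange b (suc l) X c u d = exchange-suc b l X c u d

      insertion-step : ∀ {r} c (u : Vec (Fin s) r) b L X → DistinctLabels X → (∀ b L R → DistinctLabels R → Ins b L R u ≡ Del b L R u + Θ b L R u) →
        Ins b L X (c ∷ u) ≡ Del b L X (c ∷ u) + Θ b L X (c ∷ u)
      insertion-step c u b L X d IH = begin
          Ins b L X (c ∷ u)
        ≡⟨ Ins-cons b L X c u ⟩
          Arr b L X (a ∷ c ∷ u) + Σpick X (λ y R → when (ec y) (Ins b L R u + startTerm Ins b L y R u))
        ≡⟨ cong (Arr b L X (a ∷ c ∷ u) +_) (Σpick-congPick X (λ {y} {R} sl → cong (when (ec y)) (insertion-hyp u IH b L y R (proj₁ (DistinctLabels-pick d sl))))) ⟩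
          Arr b L X (a ∷ c ∷ u) + Σpick X (λ y R → when (ec y) ((Del b L R u + startTerm Del b L y R u) + (Θ b L R u + startTerm Θ b L y R u)))
        ≡⟨ cong (Arr b L X (a ∷ c ∷ u) +_) (trans (Σpick-cong X (λ y R → when-+ (ec y) _ _)) (Σpick-+ X _ _)) ⟩
          Arr b L X (a ∷ c ∷ u) + (Σpick X (λ y R → when (ec y) (Del b L R u + startTerm Del b L y R u)) + Σpick X (λ y R → when (ec y) (Θ b L R u + startTerm Θ b L y R u)))
        ≡⟨ sym (+-assoc (Arr b L X (a ∷ c ∷ u)) _ _) ⟩
          (Arr b L X (a ∷ c ∷ u) + Σpick X (λ y R → when (ec y) (Del b L R u + startTerm Del b L y R u))) + Σpick X (λ y R → when (ec y) (Θ b L R u + startTerm Θ b L y R u))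
        ≡⟨ cong (_+ Σpick X (λ y R → when (ec y) (Θ b L R u + startTerm Θ b L y R u))) (exchange b L X c u d) ⟩
          (Del b L X (c ∷ u) + Σpick X (λ y R → when (eqF c (proj₂ y)) (Arr b L R (a ∷ u)))) + Σpick X (λ y R → when (ec y) (Θ b L R u + startTerm Θ b L y R u))
        ≡⟨ +-assoc (Del b L X (c ∷ u)) _ _ ⟩
          Del b L X (c ∷ u) + (Σpick X (λ y R → when (eqF c (proj₂ y)) (Arr b L R (a ∷ u))) + Σpick X (λ y R → when (ec y) (Θ b L R u + startTerm Θ b L y R u)))
        ≡⟨ cong (Del b L X (c ∷ u) +_) (sym (Θ-cons b L X c u)) ⟩
          Del b L X (c ∷ u) + Θ b L X (c ∷ u)
        ∎
        where
        open ≡-Reasoning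
        ec : Tile → Bool
        ec y = eqF (proj₂ y) c

      insertion-base : ∀ b L x R → isZero L + startTerm Arr b L x R [] ≡ skipTerm Arr b L x R [] + suc L * isZero L
      insertion-base b zero x R = refl
      insertion-base b (suc zero) x R = sym (+-identityʳ _)
      insertion-base b (suc (suc l)) x R = sym (trans (cong (when (above b (proj₁ x)) 0 +_) (*-zeroʳ (suc (suc (suc l))))) (+-identityʳ _))

      insertion-identity : ∀ {r} (u : Vec (Fin s) r) b L X → DistinctLabels X → Ins b L X u ≡ Del b L X u + Θ b L X u
      insertion-identity [] b L X d = begin
          Arr b L X (a ∷ []) + 0
        ≡⟨ +-identityʳ _ ⟩
          Arr b L X (a ∷ [])
        ≡⟨ Arr-cons b L X a [] ⟩
          Σpick X (λ x R → when (eqF (proj₂ x) a) (isZero L + startTerm Arr b L x R []))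
        ≡⟨ Σpick-cong X (λ x R → cong (when (eqF (proj₂ x) a)) (insertion-base b L x R)) ⟩
          Del b L X []
        ≡⟨ sym (trans (cong (Del b L X [] +_) (Σpick-0 X)) (+-identityʳ _)) ⟩
          Del b L X [] + Θ b L X []
        ∎ where open ≡-Reasoning
      insertion-identity (c ∷ u) b L X d = insertion-step c u b L X d (λ b' L' R d' → insertion-identity u b' L' R d')

module LinearCombinations where

  open import Defs
  open Sums

  open import Data.Nat using (ℕ; _*_)
  open import Data.Integer using (ℤ; +_; 0ℤ) renaming (_+_ to _+ℤ_; _*_ to _*ℤ_)
  import Data.Integer.Properties as ℤP
  open import Data.Vec.Properties using (≡-dec)
  open import Data.List using (List; []; _∷_; _++_; map; concatMap)
  open import Data.Product using (_,_)
  open import Data.Bool using (true; false; if_then_else_)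
  open import Data.Empty using (⊥-elim)
  open import Relation.Nullary using (yes; no)
  open import Relation.Nullary.Decidable using (⌊_⌋)
  open import Data.Fin.Properties using () renaming (_≟_ to _≟F_)
  open import Relation.Binary.PropositionalEquality

  sumZ : ∀ {A : Set} → List A → (A → ℤ) → ℤ
  sumZ [] f = 0ℤ
  sumZ (x ∷ xs) f = f x +ℤ sumZ xs f

  sumZ-pos : ∀ {A : Set} (xs : List A) (f : A → ℕ) → sumZ xs (λ x → + f x) ≡ + sumN xs f
  sumZ-pos [] f = refl
  sumZ-pos (x ∷ xs) f = trans (cong ((+ f x) +ℤ_) (sumZ-pos xs f)) (sym (ℤP.pos-+ (f x) _))

  sumZ-cong : ∀ {A : Set} (xs : List A) {f g : A → ℤ} → (∀ x → f x ≡ g x) → sumZ xs f ≡ sumZ xs g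
  sumZ-cong [] e = refl
  sumZ-cong (x ∷ xs) e = cong₂ _+ℤ_ (e x) (sumZ-cong xs e)

  -- lsum xs g = Σ_{(c , v) ∈ xs} c · g v: the linear functional on LC given by
  -- its values g on basis words.  Coefficients are the case g = [· = u].
  lsum : ∀ {s m} → LC s m → (Word s m → ℤ) → ℤ
  lsum [] g = 0ℤ
  lsum ((c , v) ∷ xs) g = c *ℤ g v +ℤ lsum xs g

  coeff-++ : ∀ {s m} (xs ys : LC s m) u → coeff (xs ++ ys) u ≡ coeff xs u +ℤ coeff ys u
  coeff-++ [] ys u = sym (ℤP.+-identityˡ _)
  coeff-++ ((c , v) ∷ xs) ys u = trans (cong (hd +ℤ_) (coeff-++ xs ys u)) (sym (ℤP.+-assoc hd (coeff xs u) (coeff ys u)))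
    where hd = if ⌊ ≡-dec _≟F_ v u ⌋ then c else 0ℤ

  coeff-scale : ∀ {s m} c (xs : LC s m) u → coeff (scale c xs) u ≡ c *ℤ coeff xs u
  coeff-scale c [] u = sym (ℤP.*-zeroʳ c)
  coeff-scale c ((d , v) ∷ xs) u with ⌊ ≡-dec _≟F_ v u ⌋
  ... | true = trans (cong (c *ℤ d +ℤ_) (coeff-scale c xs u)) (sym (ℤP.*-distribˡ-+ c d _))
  ... | false = trans (cong (0ℤ +ℤ_) (coeff-scale c xs u)) (sym (trans (ℤP.*-distribˡ-+ c 0ℤ _) (cong (_+ℤ c *ℤ coeff xs u) (ℤP.*-zeroʳ c))))

  coeff-lin : ∀ {s m m'} (f : Word s m → LC s m') (xs : LC s m) u → coeff (lin f xs) u ≡ lsum xs (λ v → coeff (f v) u)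
  coeff-lin f [] u = refl
  coeff-lin f ((c , v) ∷ xs) u = trans (coeff-++ (scale c (f v)) (lin f xs) u) (cong₂ _+ℤ_ (coeff-scale c (f v) u) (coeff-lin f xs u))

  lsum-cong : ∀ {s m} (xs : LC s m) {f g : Word s m → ℤ} → (∀ v → f v ≡ g v) → lsum xs f ≡ lsum xs g
  lsum-cong [] e = refl
  lsum-cong ((c , v) ∷ xs) e = cong₂ _+ℤ_ (cong (c *ℤ_) (e v)) (lsum-cong xs e)

  lsum-++ : ∀ {s m} (xs ys : LC s m) g → lsum (xs ++ ys) g ≡ lsum xs g +ℤ lsum ys g
  lsum-++ [] ys g = sym (ℤP.+-identityˡ _)
  lsum-++ ((c , v) ∷ xs) ys g = trans (cong (c *ℤ g v +ℤ_) (lsum-++ xs ys g)) (sym (ℤP.+-assoc (c *ℤ g v) (lsum xs g) (lsum ys g)))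

  lsum-scale : ∀ {s m} c (xs : LC s m) g → lsum (scale c xs) g ≡ c *ℤ lsum xs g
  lsum-scale c [] g = sym (ℤP.*-zeroʳ c)
  lsum-scale c ((d , v) ∷ xs) g = trans (cong₂ _+ℤ_ (ℤP.*-assoc c d (g v)) (lsum-scale c xs g)) (sym (ℤP.*-distribˡ-+ c _ _))

  lsum-lin : ∀ {s m m'} (f : Word s m → LC s m') (xs : LC s m) g → lsum (lin f xs) g ≡ lsum xs (λ v → lsum (f v) g)
  lsum-lin f [] g = refl
  lsum-lin f ((c , v) ∷ xs) g = trans (lsum-++ (scale c (f v)) (lin f xs) g) (cong₂ _+ℤ_ (lsum-scale c (f v) g) (lsum-lin f xs g))

  lsum-concatMap : ∀ {s m} {A : Set} (h : A → LC s m) (xs : List A) g → lsum (concatMap h xs) g ≡ sumZ xs (λ x → lsum (h x) g)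
  lsum-concatMap h [] g = refl
  lsum-concatMap h (x ∷ xs) g = trans (lsum-++ (h x) (concatMap h xs) g) (cong (lsum (h x) g +ℤ_) (lsum-concatMap h xs g))

  coeff-concatMap : ∀ {s m} {A : Set} (h : A → LC s m) (xs : List A) u → coeff (concatMap h xs) u ≡ sumZ xs (λ x → coeff (h x) u)
  coeff-concatMap h [] u = refl
  coeff-concatMap h (x ∷ xs) u = trans (coeff-++ (h x) (concatMap h xs) u) (cong (coeff (h x) u +ℤ_) (coeff-concatMap h xs u))

  δ : ∀ {s m} → Word s m → Word s m → ℕ
  δ v u = if ⌊ ≡-dec _≟F_ v u ⌋ then 1 else 0

  coeff-lsum : ∀ {s m} (xs : LC s m) u → coeff xs u ≡ lsum xs (λ v → + δ v u)
  coeff-lsum [] u = refl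
  coeff-lsum ((c , v) ∷ xs) u with ⌊ ≡-dec _≟F_ v u ⌋
  ... | true = cong₂ _+ℤ_ (sym (ℤP.*-identityʳ c)) (coeff-lsum xs u)
  ... | false = cong₂ _+ℤ_ (sym (ℤP.*-zeroʳ c)) (coeff-lsum xs u)

  lsum-map-pos : ∀ {s m} {A : Set} (xs : List A) (f : A → ℕ) (h : A → Word s m) (G : Word s m → ℕ) →
    lsum (map (λ τ → (+ f τ , h τ)) xs) (λ v → + G v) ≡ + sumN xs (λ τ → f τ * G (h τ))
  lsum-map-pos [] f h G = refl
  lsum-map-pos (x ∷ xs) f h G = trans (cong₂ _+ℤ_ (sym (ℤP.pos-* (f x) (G (h x)))) (lsum-map-pos xs f h G)) (sym (ℤP.pos-+ (f x * G (h x)) (sumN xs (λ τ → f τ * G (h τ)))))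

  lsum-ifb : ∀ {s m} e (v : Word s m) (G : Word s m → ℕ) → lsum (if e then basis v else []) (λ v → + G v) ≡ + when e (G v)
  lsum-ifb true v G = trans (ℤP.+-identityʳ _) (ℤP.*-identityˡ _)
  lsum-ifb false v G = refl

  δ-yes : ∀ {s m} {x y : Word s m} → x ≡ y → δ x y ≡ 1
  δ-yes {x = x} {y} e with ≡-dec _≟F_ x y
  ... | yes _ = refl
  ... | no ne = ⊥-elim (ne e)


module BasisOperators where

  open import Defs
  open Sums
  open LetterTests
  open LinearCombinations

  open import Data.Nat using (ℕ; suc; _∸_; _*_)
  open import Data.Integer using (+_)
  open import Data.Fin using (Fin)
  open import Data.Vec using (lookup; insertAt; updateAt; removeAt)
  import Data.Vec.Properties as VecP
  open import Data.Vec.Properties using (≡-dec)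
  open import Data.List using ([]; concatMap; allFin)
  open import Data.Product using (_×_; _,_; proj₁; proj₂)
  open import Data.Bool using (Bool; if_then_else_)
  open import Data.Empty using (⊥-elim)
  open import Relation.Nullary using (Dec; yes; no)
  open import Relation.Nullary.Decidable using (⌊_⌋)
  open import Data.Fin.Properties using () renaming (_≟_ to _≟F_)
  open import Relation.Binary.PropositionalEquality

  lsum-positions : ∀ {s m} r (test : Fin r → Bool) (word : Fin r → Word s m) (G : Word s m → ℕ) →
    lsum (concatMap (λ i → if test i then basis (word i) else []) (allFin r)) (λ v → + G v)
      ≡ + ΣF r (λ i → when (test i) (G (word i)))
  lsum-positions r test word G = begin
      lsum (concatMap (λ i → if test i then basis (word i) else []) (allFin r)) (λ v → + G v)
    ≡⟨ lsum-concatMap (λ i → if test i then basis (word i) else []) (allFin r) (λ v → + G v) ⟩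
      sumZ (allFin r) (λ i → lsum (if test i then basis (word i) else []) (λ v → + G v))
    ≡⟨ sumZ-cong (allFin r) (λ i → lsum-ifb (test i) (word i) G) ⟩
      sumZ (allFin r) (λ i → + when (test i) (G (word i)))
    ≡⟨ sumZ-pos (allFin r) _ ⟩
      + sumN (allFin r) (λ i → when (test i) (G (word i)))
    ≡⟨ cong +_ (sumN-allFin r _) ⟩
      + ΣF r (λ i → when (test i) (G (word i)))
    ∎ where open ≡-Reasoning

  lsum-∂ : ∀ {s n} (a : Fin s) (w : Word s (suc n)) (G : Word s n → ℕ) →
    lsum (∂ a w) (λ v → + G v) ≡ + ΣF (suc n) (λ i → when (eqF (lookup w i) a) (G (removeAt w i)))
  lsum-∂ {n = n} a w G = lsum-positions (suc n) (λ i → eqF (lookup w i) a) (removeAt w) G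

  remove-vs-insert : ∀ {s n} (a : Fin s) (v : Word s (suc n)) (u : Word s n) i →
    when (eqF (lookup v i) a) (δ (removeAt v i) u) ≡ δ v (insertAt u i a)
  remove-vs-insert a v u i with ≡-dec _≟F_ v (insertAt u i a)
  ... | yes refl rewrite VecP.insertAt-lookup u i a | VecP.removeAt-insertAt u i a | eqF-refl a | δ-yes (refl {x = u}) = refl
  ... | no ne with lookup v i ≟F a
  ...   | no _ = refl
  ...   | yes e1 with ≡-dec _≟F_ (removeAt v i) u
  ...     | no _ = refl
  ...     | yes e2 = ⊥-elim (ne (trans (sym (VecP.insertAt-removeAt v i)) (cong₂ (λ t t' → insertAt t i t') e2 e1)))

  coeff-∂ : ∀ {s n} (a : Fin s) (v : Word s (suc n)) (u : Word s n) →
    coeff (∂ a v) u ≡ + ΣF (suc n) (λ p → δ v (insertAt u p a))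
  coeff-∂ {n = n} a v u =
    trans (coeff-lsum (∂ a v) u) (trans (lsum-∂ a v (λ v' → δ v' u)) (cong +_ (ΣF-cong (suc n) (remove-vs-insert a v u))))

  replace-inverse : ∀ {s r} (a b : Fin s) (v u : Word s r) i → lookup v i ≡ a → updateAt v i (λ _ → b) ≡ u →
    lookup u i ≡ b × v ≡ updateAt u i (λ _ → a)
  replace-inverse a b v .(updateAt v i (λ _ → b)) i e1 refl =
    VecP.lookup∘updateAt i v , sym (trans (VecP.updateAt-updateAt i v) (VecP.updateAt-id-local i v (sym e1)))

  indicator-swap : ∀ {P Q P' Q' : Set} (p : Dec P) (q : Dec Q) (p' : Dec P') (q' : Dec Q') →
    (P → Q → P' × Q') → (P' → Q' → P × Q) →
    when ⌊ p ⌋ (if ⌊ q ⌋ then 1 else 0) ≡ when ⌊ p' ⌋ (if ⌊ q' ⌋ then 1 else 0)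
  indicator-swap (yes x) (yes y) (yes x') (yes y') to from = refl
  indicator-swap (yes x) (yes y) (no ¬x') q' to from = ⊥-elim (¬x' (proj₁ (to x y)))
  indicator-swap (yes x) (yes y) (yes x') (no ¬y') to from = ⊥-elim (¬y' (proj₂ (to x y)))
  indicator-swap (no ¬x) q (yes x') (yes y') to from = ⊥-elim (¬x (proj₁ (from x' y')))
  indicator-swap (yes x) (no ¬y) (yes x') (yes y') to from = ⊥-elim (¬y (proj₂ (from x' y')))
  indicator-swap (yes x) (no ¬y) (no ¬x') q' to from = refl
  indicator-swap (yes x) (no ¬y) (yes x') (no ¬y') to from = refl
  indicator-swap (no ¬x) q (no ¬x') q' to from = refl
  indicator-swap (no ¬x) q (yes x') (no ¬y') to from = refl

  replace-swap : ∀ {s r} (a b : Fin s) (v u : Word s r) i →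
    when (eqF (lookup v i) a) (δ (updateAt v i (λ _ → b)) u) ≡ when (eqF (lookup u i) b) (δ v (updateAt u i (λ _ → a)))
  replace-swap a b v u i =
    indicator-swap (lookup v i ≟F a) (≡-dec _≟F_ (updateAt v i (λ _ → b)) u) (lookup u i ≟F b) (≡-dec _≟F_ v (updateAt u i (λ _ → a)))
      (replace-inverse a b v u i)
      (λ e3 e4 → let (e1 , e2) = replace-inverse b a u v i e3 (sym e4) in e1 , sym e2)

  coeff-θ : ∀ {s r} (a b : Fin s) (v u : Word s r) →
    coeff (θ a b v) u ≡ + ΣF r (λ q → when (eqF (lookup u q) b) (δ v (updateAt u q (λ _ → a))))
  coeff-θ {r = r} a b v u =
    trans (coeff-lsum (θ a b v) u)
          (trans (lsum-positions r (λ i → eqF (lookup v i) a) (λ i → updateAt v i (λ _ → b)) (λ v' → δ v' u))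
                 (cong +_ (ΣF-cong r (replace-swap a b v u))))

  νcount : ∀ {s} (m k : ℕ) → Word s m → Word s m → ℕ
  νcount m k w v = sumN (Sym m) (λ τ → noninv (m ∸ k) τ * δ (act w τ) v)

  lsum-ν : ∀ {s} m k (w : Word s m) (G : Word s m → ℕ) →
    lsum (ν m k w) (λ v → + G v) ≡ + sumN (Sym m) (λ τ → noninv (m ∸ k) τ * G (act w τ))
  lsum-ν m k w G = lsum-map-pos (Sym m) (λ τ → noninv (m ∸ k) τ) (act w) G

  coeff-ν : ∀ {s} m k (w v : Word s m) → coeff (ν m k w) v ≡ + νcount m k w v
  coeff-ν m k w v = trans (coeff-lsum (ν m k w) v) (lsum-ν m k w (λ v' → δ v' v))


-- A permutation τ is read as the sequence of tiles w_{τ(1)}, …, w_{τ(m)};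
-- summing over the first entry of τ reproduces the recursion defining Arr.
module PermutationCounts where

  open import Defs
  open Sums
  open LetterTests
  open Picking
  open Arrangements
  open LinearCombinations using (δ)
  open BasisOperators

  open import Data.Nat using (ℕ; zero; suc; _∸_; _<ᵇ_; _+_; _*_)
  open import Data.Nat.Properties using (*-distribʳ-+; *-zeroʳ)
  import Data.Bool.Properties as BoolP
  open import Data.Fin using (Fin; toℕ) renaming (zero to fz; suc to fs)
  import Data.Fin.Properties as FinP
  open import Data.Vec using (Vec; []; _∷_; lookup; tabulate; toList)
  import Data.Vec as Vec
  open import Data.Vec.Properties using (≡-dec)
  open import Data.List using (List; []; _∷_; map; concatMap; allFin; filterᵇ)
  open import Data.List.Relation.Unary.All using (All; []; _∷_)
  import Data.List.Relation.Unary.All as All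
  open import Data.List.Relation.Unary.Unique.Propositional using (Unique)
  open import Data.List.Relation.Unary.AllPairs using ([]; _∷_)
  import Data.List.Relation.Unary.Unique.Propositional.Properties as UniqueP
  open import Data.List.Membership.Propositional using (_∈_)
  open import Data.List.Membership.Propositional.Properties using (∈-allFin)
  open import Data.List.Relation.Unary.Any using (here; there)
  open import Data.Product using (_×_; _,_; proj₁; proj₂)
  open import Data.Bool using (Bool; true; false; if_then_else_; _∧_; _∨_; not)
  open import Data.Maybe using (Maybe; just; nothing)
  import Data.Maybe as Maybe
  open import Data.Empty using (⊥; ⊥-elim)
  open import Relation.Nullary using (¬_; yes; no)
  open import Data.Fin.Properties using () renaming (_≟_ to _≟F_)
  open import Relation.Binary.PropositionalEquality

  δ-cons : ∀ {s r} (x y : Fin s) (xs ys : Word s r) → δ (x ∷ xs) (y ∷ ys) ≡ when (eqF x y) (δ xs ys)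
  δ-cons x y xs ys with x ≟F y | ≡-dec _≟F_ xs ys
  ... | yes refl | yes refl = refl
  ... | yes refl | no ne = refl
  ... | no ne | _ = refl

  ∧-elim : ∀ a b → a ∧ b ≡ true → a ≡ true × b ≡ true
  ∧-elim true true e = refl , refl

  bool-ext : ∀ {b c} → (b ≡ true → c ≡ true) → (c ≡ true → b ≡ true) → b ≡ c
  bool-ext {false} {false} _ _ = refl
  bool-ext {false} {true} _ c⇒b = c⇒b refl
  bool-ext {true} b⇒c _ = sym (b⇒c refl)

  ∧-shuffle : ∀ A B C D → (A ∧ B) ∧ (C ∧ D) ≡ C ∧ (B ∧ (D ∧ A))
  ∧-shuffle true true C D rewrite BoolP.∧-identityʳ D = refl
  ∧-shuffle true false C D rewrite BoolP.∧-zeroʳ C = refl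
  ∧-shuffle false B C D rewrite BoolP.∧-zeroʳ D | BoolP.∧-zeroʳ B | BoolP.∧-zeroʳ C = refl

  ∧-interchange : ∀ A B C D → (A ∧ B) ∧ (C ∧ D) ≡ (A ∧ C) ∧ (B ∧ D)
  ∧-interchange true true C D = refl
  ∧-interchange true false C D rewrite BoolP.∧-zeroʳ C = refl
  ∧-interchange false B C D = refl

  when-split-* : ∀ C e Q I T d → when C (when Q ((I + T) * when e d)) ≡ when C (when e (when Q (I * d) + when Q (T * d)))
  when-split-* false e Q I T d = refl
  when-split-* true true true I T d = *-distribʳ-+ d I T
  when-split-* true true false I T d = refl
  when-split-* true false true I T d = *-zeroʳ (I + T)
  when-split-* true false false I T d = refl

  when-*ʳ : ∀ c n d → when c n * d ≡ when c (n * d)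
  when-*ʳ true n d = refl
  when-*ʳ false n d = refl

  -- Increasing subsequences of ℓ ∷ xs either avoid ℓ or start with it.
  startInc : Maybe ℕ → ℕ → ℕ → List ℕ → ℕ
  startInc b zero ℓ xs = 0
  startInc b (suc i) ℓ xs = when (above b ℓ) (incFrom (just ℓ) i xs)

  incFrom-cons : ∀ b L ℓ xs → incFrom b L (ℓ ∷ xs) ≡ incFrom b L xs + startInc b L ℓ xs
  incFrom-cons b zero ℓ xs = refl
  incFrom-cons b (suc i) ℓ xs = cong (incFrom b (suc i) xs +_) (if-when (above b ℓ) _)

  module Tiles {s m : ℕ} (w : Word s m) (lab : Fin m → ℕ) where

    tile : Fin m → Tile {s}
    tile j = (lab j , lookup w j)

    allEntries : ∀ {r} → (Fin m → Bool) → Vec (Fin m) r → Bool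
    allEntries q [] = true
    allEntries q (x ∷ τ) = q x ∧ allEntries q τ

    distinctEntries : ∀ {r} → Vec (Fin m) r → Bool
    distinctEntries [] = true
    distinctEntries (x ∷ τ) = allEntries (λ y → not (eqF y x)) τ ∧ distinctEntries τ

    allEntries-∧ : ∀ {r} (q q' : Fin m → Bool) (τ : Vec (Fin m) r) → allEntries (λ y → q y ∧ q' y) τ ≡ allEntries q τ ∧ allEntries q' τ
    allEntries-∧ q q' [] = refl
    allEntries-∧ q q' (x ∷ τ) rewrite allEntries-∧ q q' τ = ∧-interchange (q x) (q' x) (allEntries q τ) (allEntries q' τ)

    allEntries-true : ∀ {r} (τ : Vec (Fin m) r) → allEntries (λ _ → true) τ ≡ true
    allEntries-true [] = refl
    allEntries-true (x ∷ τ) = allEntries-true τ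

    except : (Fin m → Bool) → Fin m → Fin m → Bool
    except p x y = p y ∧ not (eqF y x)

    Σpick-filter : ∀ (ys : List (Fin m)) → Unique ys → ∀ p (F : Tile → List Tile → ℕ) →
      Σpick (map tile (filterᵇ p ys)) F ≡ sumN ys (λ x → when (p x) (F (tile x) (map tile (filterᵇ (except p x) ys))))
    Σpick-filter [] d p F = refl
    Σpick-filter (z ∷ zs) (nz ∷ d) p F = by-test (p z) refl
      where
      except-other : ∀ y → ¬ z ≡ y → except p z y ≡ p y
      except-other y ne rewrite eqF-no (λ e → ne (sym e)) = BoolP.∧-identityʳ (p y)
      except-self : except p z z ≡ false
      except-self rewrite eqF-refl z = BoolP.∧-zeroʳ (p z)
      RHS : List (Fin m) → ℕ
      RHS ys = sumN ys (λ x → when (p x) (F (tile x) (map tile (filterᵇ (except p x) (z ∷ zs)))))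
      by-test : ∀ b → p z ≡ b → Σpick (map tile (filterᵇ p (z ∷ zs))) F ≡ RHS (z ∷ zs)
      by-test true eq rewrite filter-true p z zs eq | filter-false (except p z) z zs except-self
             = cong₂ _+_ (trans (cong (λ t → F (tile z) (map tile t)) (filter-congAll p (except p z) zs (All.map (λ {y} ne → sym (except-other y ne)) nz)))
                                (cong (λ b → when b (F (tile z) (map tile (filterᵇ (except p z) zs)))) (sym eq)))
                         (trans (Σpick-filter zs d p (λ x R → F x (tile z ∷ R)))
                                (sumN-congAll zs (All.map (λ {x} ne → cong (λ t → when (p x) (F (tile x) (map tile t))) (sym (filter-true (except p x) z zs (keeps-z x ne)))) nz)))
        where
        keeps-z : ∀ x → ¬ z ≡ x → except p x z ≡ true
        keeps-z x ne rewrite eq | eqF-no ne = refl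
      by-test false eq rewrite filter-false p z zs eq
             = trans (Σpick-filter zs d p F)
                (trans (sumN-congAll zs (All.tabulate (λ {x} _ → cong (λ t → when (p x) (F (tile x) (map tile t))) (sym (filter-false (except p x) z zs (cong (λ t → t ∧ not (eqF z x)) eq))))))
                       (cong (λ b → when b (F (tile z) (map tile (filterᵇ (except p z) (z ∷ zs)))) + RHS zs) (sym eq)))

    sequences≡Arr : ∀ {r} (u : Word s r) b L (p : Fin m → Bool) →
      sumN (allVecs m r) (λ τ → when (distinctEntries τ ∧ allEntries p τ) (incFrom b L (toList (Vec.map lab τ)) * δ (Vec.map (lookup w) τ) u))
        ≡ Arr b L (map tile (filterᵇ p (allFin m))) u
    sequences≡Arr [] b zero p = refl
    sequences≡Arr [] b (suc L) p = refl
    sequences≡Arr {suc r} (c ∷ u) b L p = begin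
        sumN (concatMap (λ x → map (x ∷_) (allVecs m r)) (allFin m)) summand
      ≡⟨ sumN-concatMap (λ x → map (x ∷_) (allVecs m r)) (allFin m) summand ⟩
        sumN (allFin m) (λ x → sumN (map (x ∷_) (allVecs m r)) summand)
      ≡⟨ sumN-cong (allFin m) (λ x → trans (sumN-map (x ∷_) (allVecs m r) summand) (first-entry x)) ⟩
        sumN (allFin m) (λ x → when (p x) (F (tile x) (map tile (filterᵇ (except p x) (allFin m)))))
      ≡⟨ sym (Σpick-filter (allFin m) (UniqueP.allFin⁺ m) p F) ⟩
        Σpick (map tile (filterᵇ p (allFin m))) F
      ≡⟨ sym (Arr-cons b L (map tile (filterᵇ p (allFin m))) c u) ⟩
        Arr b L (map tile (filterᵇ p (allFin m))) (c ∷ u)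
      ∎
      where
      open ≡-Reasoning
      summand : Vec (Fin m) (suc r) → ℕ
      summand τ = when (distinctEntries τ ∧ allEntries p τ) (incFrom b L (toList (Vec.map lab τ)) * δ (Vec.map (lookup w) τ) (c ∷ u))
      F : Tile → List Tile → ℕ
      F y R = when (eqF (proj₂ y) c) (Arr b L R u + startTerm Arr b L y R u)
      first-entry : ∀ x → sumN (allVecs m r) (λ τ → summand (x ∷ τ)) ≡ when (p x) (F (tile x) (map tile (filterᵇ (except p x) (allFin m))))
      first-entry x = begin
          sumN (allVecs m r) (λ τ → summand (x ∷ τ))
        ≡⟨ sumN-cong (allVecs m r) split-summand ⟩
          sumN (allVecs m r) (λ τ → when (p x) (when (eqF (lookup w x) c) (when (Q τ) (incFrom b L (lt τ) * d τ) + when (Q τ) (startInc b L (lab x) (lt τ) * d τ))))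
        ≡⟨ trans (sumN-when (allVecs m r) (p x) _) (cong (when (p x)) (trans (sumN-when (allVecs m r) (eqF (lookup w x) c) _)
                   (cong (when (eqF (lookup w x) c)) (sumN-+ (allVecs m r) _ _)))) ⟩
          when (p x) (when (eqF (lookup w x) c) (sumN (allVecs m r) (λ τ → when (Q τ) (incFrom b L (lt τ) * d τ))
                                                  + sumN (allVecs m r) (λ τ → when (Q τ) (startInc b L (lab x) (lt τ) * d τ))))
        ≡⟨ cong (λ t → when (p x) (when (eqF (lookup w x) c) t)) (cong₂ _+_ (sequences≡Arr u b L (except p x)) (starting-at-x L)) ⟩
          when (p x) (F (tile x) (map tile (filterᵇ (except p x) (allFin m))))
        ∎
        where
        Q : Vec (Fin m) r → Bool
        Q τ = distinctEntries τ ∧ allEntries (except p x) τ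
        lt : Vec (Fin m) r → List ℕ
        lt τ = toList (Vec.map lab τ)
        d : Vec (Fin m) r → ℕ
        d τ = δ (Vec.map (lookup w) τ) u
        split-summand : ∀ τ → summand (x ∷ τ) ≡ when (p x) (when (eqF (lookup w x) c) (when (Q τ) (incFrom b L (lt τ) * d τ) + when (Q τ) (startInc b L (lab x) (lt τ) * d τ)))
        split-summand τ = begin
            when ((allEntries (λ y → not (eqF y x)) τ ∧ distinctEntries τ) ∧ (p x ∧ allEntries p τ)) (incFrom b L (lab x ∷ lt τ) * δ (lookup w x ∷ Vec.map (lookup w) τ) (c ∷ u))
          ≡⟨ cong₂ (λ t t' → when t (incFrom b L (lab x ∷ lt τ) * t'))
                   (trans (∧-shuffle (allEntries (λ y → not (eqF y x)) τ) (distinctEntries τ) (p x) (allEntries p τ))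
                          (cong (λ t → p x ∧ (distinctEntries τ ∧ t)) (sym (allEntries-∧ p (λ y → not (eqF y x)) τ))))
                   (δ-cons (lookup w x) c (Vec.map (lookup w) τ) u) ⟩
            when (p x ∧ Q τ) (incFrom b L (lab x ∷ lt τ) * when (eqF (lookup w x) c) (d τ))
          ≡⟨ when-∧ (p x) (Q τ) _ ⟩
            when (p x) (when (Q τ) (incFrom b L (lab x ∷ lt τ) * when (eqF (lookup w x) c) (d τ)))
          ≡⟨ cong (λ t → when (p x) (when (Q τ) (t * when (eqF (lookup w x) c) (d τ)))) (incFrom-cons b L (lab x) (lt τ)) ⟩
            when (p x) (when (Q τ) ((incFrom b L (lt τ) + startInc b L (lab x) (lt τ)) * when (eqF (lookup w x) c) (d τ)))
          ≡⟨ when-split-* (p x) (eqF (lookup w x) c) (Q τ) (incFrom b L (lt τ)) (startInc b L (lab x) (lt τ)) (d τ) ⟩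
            when (p x) (when (eqF (lookup w x) c) (when (Q τ) (incFrom b L (lt τ) * d τ) + when (Q τ) (startInc b L (lab x) (lt τ) * d τ)))
          ∎
        starting-at-x : ∀ L → sumN (allVecs m r) (λ τ → when (Q τ) (startInc b L (lab x) (lt τ) * d τ)) ≡ startTerm Arr b L (tile x) (map tile (filterᵇ (except p x) (allFin m))) u
        starting-at-x zero = trans (sumN-cong (allVecs m r) (λ τ → when-0 (Q τ))) (sumN-0 (allVecs m r))
        starting-at-x (suc i) = begin
            sumN (allVecs m r) (λ τ → when (Q τ) (when (above b (lab x)) (incFrom (just (lab x)) i (lt τ)) * d τ))
          ≡⟨ sumN-cong (allVecs m r) (λ τ → trans (cong (when (Q τ)) (when-*ʳ (above b (lab x)) _ (d τ))) (when-comm (Q τ) (above b (lab x)) _)) ⟩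
            sumN (allVecs m r) (λ τ → when (above b (lab x)) (when (Q τ) (incFrom (just (lab x)) i (lt τ) * d τ)))
          ≡⟨ sumN-when (allVecs m r) (above b (lab x)) _ ⟩
            when (above b (lab x)) (sumN (allVecs m r) (λ τ → when (Q τ) (incFrom (just (lab x)) i (lt τ) * d τ)))
          ≡⟨ cong (when (above b (lab x))) (sequences≡Arr u (just (lab x)) i (except p x)) ⟩
            startTerm Arr b (suc i) (tile x) (map tile (filterᵇ (except p x) (allFin m))) u
          ∎

    InjectiveVec : ∀ {r} → Vec (Fin m) r → Set
    InjectiveVec τ = ∀ i j → lookup τ i ≡ lookup τ j → i ≡ j

    allEntries-elim : ∀ {r} q (τ : Vec (Fin m) r) → allEntries q τ ≡ true → ∀ j → q (lookup τ j) ≡ true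
    allEntries-elim q (x ∷ τ) e fz = proj₁ (∧-elim (q x) _ e)
    allEntries-elim q (x ∷ τ) e (fs j) = allEntries-elim q τ (proj₂ (∧-elim (q x) _ e)) j

    allEntries-intro : ∀ {r} q (τ : Vec (Fin m) r) → (∀ j → q (lookup τ j) ≡ true) → allEntries q τ ≡ true
    allEntries-intro q [] h = refl
    allEntries-intro q (x ∷ τ) h rewrite h fz = allEntries-intro q τ (λ j → h (fs j))

    not-eqF : ∀ (y x : Fin m) → not (eqF y x) ≡ true → ¬ y ≡ x
    not-eqF y x e refl rewrite eqF-refl y = case e
      where
      case : false ≡ true → ⊥
      case ()

    distinctEntries-sound : ∀ {r} (τ : Vec (Fin m) r) → distinctEntries τ ≡ true → InjectiveVec τ
    distinctEntries-sound (x ∷ τ) e fz fz _ = refl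
    distinctEntries-sound (x ∷ τ) e fz (fs j) eq = ⊥-elim (not-eqF (lookup τ j) x (allEntries-elim _ τ (proj₁ (∧-elim _ _ e)) j) (sym eq))
    distinctEntries-sound (x ∷ τ) e (fs i) fz eq = ⊥-elim (not-eqF (lookup τ i) x (allEntries-elim _ τ (proj₁ (∧-elim _ _ e)) i) eq)
    distinctEntries-sound (x ∷ τ) e (fs i) (fs j) eq = cong fs (distinctEntries-sound τ (proj₂ (∧-elim _ _ e)) i j eq)

    distinctEntries-complete : ∀ {r} (τ : Vec (Fin m) r) → InjectiveVec τ → distinctEntries τ ≡ true
    distinctEntries-complete [] h = refl
    distinctEntries-complete (x ∷ τ) h =
      cong₂ _∧_ (allEntries-intro (λ y → not (eqF y x)) τ differs) (distinctEntries-complete τ (λ i j e → FinP.suc-injective (h (fs i) (fs j) e)))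
      where
      differs : ∀ j → not (eqF (lookup τ j) x) ≡ true
      differs j with lookup τ j ≟F x
      ... | yes e = case (h (fs j) fz e)
        where
        case : fs j ≡ fz → not true ≡ true
        case ()
      ... | no _ = refl

    allᵇ-elim : ∀ {X : Set} (p : X → Bool) xs → allᵇ p xs ≡ true → ∀ {x} → x ∈ xs → p x ≡ true
    allᵇ-elim p (y ∷ xs) e (here refl) = proj₁ (∧-elim (p y) _ e)
    allᵇ-elim p (y ∷ xs) e (there mem) = allᵇ-elim p xs (proj₂ (∧-elim (p y) _ e)) mem

    allᵇ-intro : ∀ {X : Set} (p : X → Bool) xs → (∀ {x} → x ∈ xs → p x ≡ true) → allᵇ p xs ≡ true
    allᵇ-intro p [] h = refl
    allᵇ-intro p (y ∷ xs) h rewrite h (here refl) = allᵇ-intro p xs (λ mem → h (there mem))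

    injectiveᵇ-sound : (τ : Vec (Fin m) m) → injectiveᵇ τ ≡ true → InjectiveVec τ
    injectiveᵇ-sound τ e i j eq = eqF→≡ i j (pair-test (allᵇ-elim _ (allFin m) (allᵇ-elim _ (allFin m) e (∈-allFin i)) (∈-allFin j)))
      where
      pair-test : not (eqF (lookup τ i) (lookup τ j)) ∨ eqF i j ≡ true → eqF i j ≡ true
      pair-test h rewrite eqF-yes eq = h

    injectiveᵇ-complete : (τ : Vec (Fin m) m) → InjectiveVec τ → injectiveᵇ τ ≡ true
    injectiveᵇ-complete τ h = allᵇ-intro _ (allFin m) (λ {i} _ → allᵇ-intro _ (allFin m) (λ {j} _ → pair-test i j))
      where
      pair-test : ∀ i j → not (eqF (lookup τ i) (lookup τ j)) ∨ eqF i j ≡ true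
      pair-test i j with lookup τ i ≟F lookup τ j
      ... | yes e rewrite eqF-yes (h i j e) = refl
      ... | no _ = refl

    injectiveᵇ≡distinctEntries : (τ : Vec (Fin m) m) → injectiveᵇ τ ≡ distinctEntries τ
    injectiveᵇ≡distinctEntries τ =
      bool-ext (λ e → distinctEntries-complete τ (injectiveᵇ-sound τ e)) (λ e → injectiveᵇ-complete τ (distinctEntries-sound τ e))

    act-map : ∀ {r} (τ : Vec (Fin m) r) → tabulate (λ i → lookup w (lookup τ i)) ≡ Vec.map (lookup w) τ
    act-map [] = refl
    act-map (x ∷ τ) = cong (lookup w x ∷_) (act-map τ)

    module Relabel (mono : ∀ i j → (toℕ i <ᵇ toℕ j) ≡ (lab i <ᵇ lab j)) where
      above-relabel : ∀ (bb : Maybe (Fin m)) x → above (Maybe.map toℕ bb) (toℕ x) ≡ above (Maybe.map lab bb) (lab x)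
      above-relabel nothing x = refl
      above-relabel (just y) x = mono y x

      incFrom-relabel : ∀ {r} (bb : Maybe (Fin m)) L (τ : Vec (Fin m) r) →
        incFrom (Maybe.map toℕ bb) L (toList (Vec.map toℕ τ)) ≡ incFrom (Maybe.map lab bb) L (toList (Vec.map lab τ))
      incFrom-relabel bb zero τ = refl
      incFrom-relabel bb (suc i) [] = refl
      incFrom-relabel bb (suc i) (x ∷ τ) rewrite above-relabel bb x =
        cong₂ _+_ (incFrom-relabel bb (suc i) τ) (starting-at-x (above (Maybe.map lab bb) (lab x)))
        where
        starting-at-x : ∀ c → (if c then incFrom (just (toℕ x)) i (toList (Vec.map toℕ τ)) else 0) ≡ (if c then incFrom (just (lab x)) i (toList (Vec.map lab τ)) else 0)
        starting-at-x true = incFrom-relabel (just x) i τ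
        starting-at-x false = refl

      νcount≡Arr : ∀ k (v : Word s m) → νcount m k w v ≡ Arr nothing (m ∸ k) (map tile (allFin m)) v
      νcount≡Arr k v = begin
          sumN (filterᵇ injectiveᵇ (allVecs m m)) (λ τ → noninv (m ∸ k) τ * δ (act w τ) v)
        ≡⟨ sumN-filter injectiveᵇ (allVecs m m) _ ⟩
          sumN (allVecs m m) (λ τ → when (injectiveᵇ τ) (noninv (m ∸ k) τ * δ (act w τ) v))
        ≡⟨ sumN-cong (allVecs m m) (λ τ → cong₂ when (tests τ) (cong₂ _*_ (incFrom-relabel nothing (m ∸ k) τ) (cong (λ t → δ t v) (act-map τ)))) ⟩
          sumN (allVecs m m) (λ τ → when (distinctEntries τ ∧ allEntries (λ _ → true) τ) (incFrom nothing (m ∸ k) (toList (Vec.map lab τ)) * δ (Vec.map (lookup w) τ) v))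
        ≡⟨ sequences≡Arr v nothing (m ∸ k) (λ _ → true) ⟩
          Arr nothing (m ∸ k) (map tile (filterᵇ (λ _ → true) (allFin m))) v
        ≡⟨ cong (λ t → Arr nothing (m ∸ k) (map tile t) v) (filter-id (allFin m)) ⟩
          Arr nothing (m ∸ k) (map tile (allFin m)) v
        ∎
        where
        open ≡-Reasoning
        tests : ∀ τ → injectiveᵇ τ ≡ distinctEntries τ ∧ allEntries (λ _ → true) τ
        tests τ = trans (injectiveᵇ≡distinctEntries τ) (sym (trans (cong (distinctEntries τ ∧_) (allEntries-true τ)) (BoolP.∧-identityʳ (distinctEntries τ))))


module Assembly where

  open import Defs
  open Sums
  open LetterTests
  open Picking
  open Arrangements
  open LinearCombinations
  open BasisOperators
  open PermutationCounts

  open import Data.Nat using (ℕ; zero; suc; _+_; _*_; _∸_; _<ᵇ_; _≤_; s≤s)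
  open import Data.Nat.Properties using (+-identityʳ)
  open import Data.Integer using (+_) renaming (_+_ to _+ℤ_; _*_ to _*ℤ_)
  import Data.Integer.Properties as ℤP
  open import Data.Fin using (Fin; toℕ; punchIn) renaming (zero to fz; suc to fs)
  import Data.Fin.Properties as FinP
  open import Data.Vec using (Vec; _∷_; lookup; insertAt; removeAt)
  import Data.Vec.Properties as VecP
  open import Data.List using (List; _∷_; map; concatMap; allFin; filterᵇ; tabulate)
  import Data.List.Properties as ListP
  import Data.List.Relation.Unary.All.Properties as AllP
  import Data.List.Relation.Unary.AllPairs as AllPairs
  import Data.List.Relation.Unary.AllPairs.Properties as AllPairsP
  import Data.List.Relation.Unary.Unique.Propositional.Properties as UniqueP
  open import Data.Product using (_,_; proj₂)
  open import Data.Bool using (Bool; true; not)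
  open import Data.Maybe using (nothing)
  open import Relation.Binary.PropositionalEquality

  ΣF-indicator : ∀ s (c : Fin s) (F : Fin s → ℕ) → ΣF s (λ b → when (eqF c b) (F b)) ≡ F c
  ΣF-indicator (suc s) fz F = trans (cong (_+_ (F fz)) (trans (ΣF-cong s (λ b → cong (λ t → when t (F (fs b))) (eqF-no {x = fz} {y = fs b} (λ ())))) (ΣF-0 s))) (+-identityʳ (F fz))
  ΣF-indicator (suc s) (fs c) F = trans (cong (λ t → t + ΣF s (λ b → when (eqF (fs c) (fs b)) (F (fs b)))) (cong (λ t → when t (F fz)) (eqF-no {x = fs c} {y = fz} (λ ()))))
                                        (trans (ΣF-cong s (λ b → cong (λ t → when t (F (fs b))) (eqF-suc c b))) (ΣF-indicator s c (λ b → F (fs b))))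

  filter-punchIn : ∀ {M} n (i : Fin (suc n)) (f : Fin (suc n) → Fin M) (q : Fin M → Bool) → (∀ j → q (f j) ≡ not (eqF j i)) →
    filterᵇ q (tabulate f) ≡ tabulate (λ j → f (punchIn i j))
  filter-punchIn n fz f q h =
    trans (filter-false q (f fz) (tabulate (λ j → f (fs j))) (trans (h fz) (cong not (eqF-refl (fz {n})))))
          (trans (filter-congAll q (λ _ → true) (tabulate (λ j → f (fs j))) (AllP.tabulate⁺ (λ j → trans (h (fs j)) (cong not (eqF-no {x = fs j} {y = fz} (λ ()))))))
                 (filter-id (tabulate (λ j → f (fs j)))))
  filter-punchIn (suc n) (fs i) f q h =
    trans (filter-true q (f fz) (tabulate (λ j → f (fs j))) (trans (h fz) (cong not (eqF-no {x = fz} {y = fs i} (λ ())))))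
          (cong (f fz ∷_) (filter-punchIn n i (λ j → f (fs j)) q (λ j → trans (h (fs j)) (cong not (eqF-suc j i)))))

  removeAt-punchIn : ∀ {A : Set} {n} (v : Vec A (suc n)) i j → lookup (removeAt v i) j ≡ lookup v (punchIn i j)
  removeAt-punchIn v i j =
    trans (sym (VecP.insertAt-punchIn (removeAt v i) i (lookup v i) j)) (cong (λ t → lookup t (punchIn i j)) (VecP.insertAt-removeAt v i))

  punchIn-<ᵇ : ∀ {n} (i : Fin (suc n)) (x y : Fin n) → (toℕ x <ᵇ toℕ y) ≡ (toℕ (punchIn i x) <ᵇ toℕ (punchIn i y))
  punchIn-<ᵇ fz x y = refl
  punchIn-<ᵇ (fs i) fz fz = refl
  punchIn-<ᵇ (fs i) fz (fs y) = refl
  punchIn-<ᵇ (fs i) (fs x) fz = refl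
  punchIn-<ᵇ (fs i) (fs x) (fs y) = punchIn-<ᵇ i x y

  lsum-ν-indicators : ∀ {s} m k r (v' : Word s m) (test : Fin r → Bool) (word : Fin r → Word s m) →
    lsum (ν m k v') (λ v → + ΣF r (λ q → when (test q) (δ v (word q)))) ≡ + ΣF r (λ q → when (test q) (νcount m k v' (word q)))
  lsum-ν-indicators m k r v' test word = trans (lsum-ν m k v' _) (cong +_ (begin
      sumN (Sym m) (λ τ → noninv (m ∸ k) τ * ΣF r (λ q → when (test q) (δ (act v' τ) (word q))))
    ≡⟨ sumN-cong (Sym m) (λ τ → trans (sym (ΣF-* r (noninv (m ∸ k) τ) _)) (ΣF-cong r (λ q → sym (when-* (test q) (noninv (m ∸ k) τ) _)))) ⟩
      sumN (Sym m) (λ τ → ΣF r (λ q → when (test q) (noninv (m ∸ k) τ * δ (act v' τ) (word q))))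
    ≡⟨ sumN-ΣF (Sym m) r _ ⟩
      ΣF r (λ q → sumN (Sym m) (λ τ → when (test q) (noninv (m ∸ k) τ * δ (act v' τ) (word q))))
    ≡⟨ ΣF-cong r (λ q → sumN-when (Sym m) (test q) _) ⟩
      ΣF r (λ q → when (test q) (νcount m k v' (word q)))
    ∎))
    where open ≡-Reasoning

  module Coefficients {s n' : ℕ} (a : Fin s) (w : Word s (suc n')) (u : Word s n') where
    n : ℕ
    n = suc n'
    module T = Tiles w toℕ
    open T.Relabel (λ i j → refl)
    open FixedLetter a public

    tile : Fin n → Tile
    tile = T.tile

    X : List Tile
    X = map tile (allFin n)

    R : Fin n → List Tile
    R i = map tile (filterᵇ (T.except (λ _ → true) i) (allFin n))

    tiles-distinct : DistinctLabels X
    tiles-distinct = AllPairsP.map⁺ (AllPairs.map (λ i≢j e → i≢j (FinP.toℕ-injective e)) (UniqueP.allFin⁺ n))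

    Σpick-tiles : ∀ F → Σpick X F ≡ ΣF n (λ i → F (tile i) (R i))
    Σpick-tiles F = trans (cong (λ t → Σpick (map tile t) F) (sym (filter-id (allFin n))))
                          (trans (T.Σpick-filter (allFin n) (UniqueP.allFin⁺ n) (λ _ → true) F) (sumN-allFin n _))

    -- The tiles of w without its i-th letter are the tiles of removeAt w i,
    -- up to an order-preserving relabelling.
    tiles-removeAt : ∀ i → map (Tiles.tile (removeAt w i) (λ j → toℕ (punchIn i j))) (allFin n') ≡ R i
    tiles-removeAt i = begin
        map (Tiles.tile (removeAt w i) (λ j → toℕ (punchIn i j))) (allFin n')
      ≡⟨ ListP.map-tabulate (λ j → j) (Tiles.tile (removeAt w i) (λ j → toℕ (punchIn i j))) ⟩
        tabulate (λ j → (toℕ (punchIn i j) , lookup (removeAt w i) j))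
      ≡⟨ ListP.tabulate-cong (λ j → cong (toℕ (punchIn i j) ,_) (removeAt-punchIn w i j)) ⟩
        tabulate (λ j → tile (punchIn i j))
      ≡⟨ sym (ListP.map-tabulate (punchIn i) tile) ⟩
        map tile (tabulate (punchIn i))
      ≡⟨ cong (map tile) (sym (filter-punchIn n' i (λ j → j) (T.except (λ _ → true) i) (λ j → refl))) ⟩
        R i
      ∎ where open ≡-Reasoning

    νcount-removeAt : ∀ k (i : Fin n) (v : Word s n') → νcount n' k (removeAt w i) v ≡ Arr nothing (n' ∸ k) (R i) v
    νcount-removeAt k i v = trans (Tiles.Relabel.νcount≡Arr (removeAt w i) (λ j → toℕ (punchIn i j)) (punchIn-<ᵇ i) k v)
                                  (cong (λ t → Arr nothing (n' ∸ k) t v) (tiles-removeAt i))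

    deleted : ℕ → ℕ
    deleted L = ΣF n (λ i → when (eqF (lookup w i) a) (Arr nothing L (R i) u))

    replaced : ℕ → ℕ
    replaced L = ΣF n (λ i → ΣF n' (λ q → when (eqF (lookup u q) (lookup w i)) (Arr nothing L (R i) (setA u q))))

    coeff-∂ν : ∀ k → coeff (lin (∂ a) (ν n k w)) u ≡ + Ins nothing (n ∸ k) X u
    coeff-∂ν k = begin
        coeff (lin (∂ a) (ν n k w)) u
      ≡⟨ coeff-lin (∂ a) (ν n k w) u ⟩
        lsum (ν n k w) (λ v → coeff (∂ a v) u)
      ≡⟨ lsum-cong (ν n k w) (λ v → coeff-∂ a v u) ⟩
        lsum (ν n k w) (λ v → + ΣF n (λ p → δ v (insertAt u p a)))
      ≡⟨ lsum-ν-indicators n k n w (λ _ → true) (λ p → insertAt u p a) ⟩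
        + ΣF n (λ p → νcount n k w (insertAt u p a))
      ≡⟨ cong +_ (ΣF-cong n (λ p → νcount≡Arr k (insertAt u p a))) ⟩
        + Ins nothing (n ∸ k) X u
      ∎ where open ≡-Reasoning

    coeff-ν∂ : ∀ k → coeff (lin (ν n' k) (∂ a w)) u ≡ + deleted (n' ∸ k)
    coeff-ν∂ k = begin
        coeff (lin (ν n' k) (∂ a w)) u
      ≡⟨ coeff-lin (ν n' k) (∂ a w) u ⟩
        lsum (∂ a w) (λ v → coeff (ν n' k v) u)
      ≡⟨ lsum-cong (∂ a w) (λ v → coeff-ν n' k v u) ⟩
        lsum (∂ a w) (λ v → + νcount n' k v u)
      ≡⟨ lsum-∂ a w (λ v → νcount n' k v u) ⟩
        + ΣF n (λ i → when (eqF (lookup w i) a) (νcount n' k (removeAt w i) u))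
      ≡⟨ cong +_ (ΣF-cong n (λ i → cong (when (eqF (lookup w i) a)) (νcount-removeAt k i u))) ⟩
        + deleted (n' ∸ k)
      ∎ where open ≡-Reasoning

    coeff-θν∂-letter : ∀ k b → coeff (lin (θ a b) (lin (ν n' k) (∂ b w))) u
      ≡ + ΣF n (λ i → when (eqF (lookup w i) b) (ΣF n' (λ q → when (eqF (lookup u q) b) (Arr nothing (n' ∸ k) (R i) (setA u q)))))
    coeff-θν∂-letter k b = begin
        coeff (lin (θ a b) (lin (ν n' k) (∂ b w))) u
      ≡⟨ coeff-lin (θ a b) (lin (ν n' k) (∂ b w)) u ⟩
        lsum (lin (ν n' k) (∂ b w)) (λ v → coeff (θ a b v) u)
      ≡⟨ lsum-cong (lin (ν n' k) (∂ b w)) (λ v → coeff-θ a b v u) ⟩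
        lsum (lin (ν n' k) (∂ b w)) (λ v → + ΣF n' (λ q → when (eqF (lookup u q) b) (δ v (setA u q))))
      ≡⟨ lsum-lin (ν n' k) (∂ b w) _ ⟩
        lsum (∂ b w) (λ v' → lsum (ν n' k v') (λ v → + ΣF n' (λ q → when (eqF (lookup u q) b) (δ v (setA u q)))))
      ≡⟨ lsum-cong (∂ b w) (λ v' → lsum-ν-indicators n' k n' v' (λ q → eqF (lookup u q) b) (setA u)) ⟩
        lsum (∂ b w) (λ v' → + ΣF n' (λ q → when (eqF (lookup u q) b) (νcount n' k v' (setA u q))))
      ≡⟨ lsum-∂ b w (λ v' → ΣF n' (λ q → when (eqF (lookup u q) b) (νcount n' k v' (setA u q)))) ⟩
        + ΣF n (λ i → when (eqF (lookup w i) b) (ΣF n' (λ q → when (eqF (lookup u q) b) (νcount n' k (removeAt w i) (setA u q)))))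
      ≡⟨ cong +_ (ΣF-cong n (λ i → cong (when (eqF (lookup w i) b)) (ΣF-cong n' (λ q → cong (when (eqF (lookup u q) b)) (νcount-removeAt k i (setA u q)))))) ⟩
        + ΣF n (λ i → when (eqF (lookup w i) b) (ΣF n' (λ q → when (eqF (lookup u q) b) (Arr nothing (n' ∸ k) (R i) (setA u q)))))
      ∎ where open ≡-Reasoning

    -- Summing over b, only b = w_i survives.
    coeff-θν∂ : ∀ k → coeff (concatMap (λ b → lin (θ a b) (lin (ν n' k) (∂ b w))) (allFin s)) u ≡ + replaced (n' ∸ k)
    coeff-θν∂ k = begin
        coeff (concatMap (λ b → lin (θ a b) (lin (ν n' k) (∂ b w))) (allFin s)) u
      ≡⟨ coeff-concatMap (λ b → lin (θ a b) (lin (ν n' k) (∂ b w))) (allFin s) u ⟩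
        sumZ (allFin s) (λ b → coeff (lin (θ a b) (lin (ν n' k) (∂ b w))) u)
      ≡⟨ sumZ-cong (allFin s) (coeff-θν∂-letter k) ⟩
        sumZ (allFin s) (λ b → + ΣF n (λ i → when (eqF (lookup w i) b) (G b i)))
      ≡⟨ sumZ-pos (allFin s) _ ⟩
        + sumN (allFin s) (λ b → ΣF n (λ i → when (eqF (lookup w i) b) (G b i)))
      ≡⟨ cong +_ (sumN-allFin s _) ⟩
        + ΣF s (λ b → ΣF n (λ i → when (eqF (lookup w i) b) (G b i)))
      ≡⟨ cong +_ (ΣF-swap s n (λ b i → when (eqF (lookup w i) b) (G b i))) ⟩
        + ΣF n (λ i → ΣF s (λ b → when (eqF (lookup w i) b) (G b i)))
      ≡⟨ cong +_ (ΣF-cong n (λ i → ΣF-indicator s (lookup w i) (λ b → G b i))) ⟩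
        + replaced (n' ∸ k)
      ∎
      where
      open ≡-Reasoning
      G : Fin s → Fin n → ℕ
      G b i = ΣF n' (λ q → when (eqF (lookup u q) b) (Arr nothing (n' ∸ k) (R i) (setA u q)))

    Del-tiles : ∀ l → Del nothing (suc l) X u ≡ deleted l + suc (suc l) * deleted (suc l)
    Del-tiles l = begin
        Del nothing (suc l) X u
      ≡⟨ Σpick-cong X {g = λ x R' → del l x R' + suc (suc l) * del (suc l) x R'}
           (λ x R' → trans (when-+ (ea x) (Arr nothing l R' u) _) (cong (_+_ (del l x R')) (when-* (ea x) (suc (suc l)) _))) ⟩
        Σpick X (λ x R' → del l x R' + suc (suc l) * del (suc l) x R')
      ≡⟨ Σpick-+ X (del l) (λ x R' → suc (suc l) * del (suc l) x R') ⟩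
        Σpick X (del l) + Σpick X (λ x R' → suc (suc l) * del (suc l) x R')
      ≡⟨ cong₂ _+_ (Σpick-tiles (del l)) (trans (Σpick-* X (suc (suc l)) (del (suc l))) (cong (suc (suc l) *_) (Σpick-tiles (del (suc l))))) ⟩
        deleted l + suc (suc l) * deleted (suc l)
      ∎
      where
      open ≡-Reasoning
      ea : Tile → Bool
      ea x = eqF (proj₂ x) a
      del : ℕ → Tile → List Tile → ℕ
      del L x R' = when (ea x) (Arr nothing L R' u)

    insertion-tiles : ∀ L l → L ≡ suc l →
      + Ins nothing L X u ≡ + deleted l +ℤ + suc L *ℤ + deleted L +ℤ + replaced L
    insertion-tiles .(suc l) l refl = begin
        + Ins nothing (suc l) X u
      ≡⟨ cong +_ (insertion-identity u nothing (suc l) X tiles-distinct) ⟩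
        + (Del nothing (suc l) X u + Θ nothing (suc l) X u)
      ≡⟨ cong +_ (cong₂ _+_ (Del-tiles l) (Σpick-tiles (λ x R' → ΣF n' (λ q → when (eqF (lookup u q) (proj₂ x)) (Arr nothing (suc l) R' (setA u q)))))) ⟩
        + (deleted l + suc (suc l) * deleted (suc l) + replaced (suc l))
      ≡⟨ ℤP.pos-+ (deleted l + suc (suc l) * deleted (suc l)) (replaced (suc l)) ⟩
        + (deleted l + suc (suc l) * deleted (suc l)) +ℤ + replaced (suc l)
      ≡⟨ cong (_+ℤ + replaced (suc l)) (ℤP.pos-+ (deleted l) (suc (suc l) * deleted (suc l))) ⟩
        + deleted l +ℤ + (suc (suc l) * deleted (suc l)) +ℤ + replaced (suc l)
      ≡⟨ cong (λ t → + deleted l +ℤ t +ℤ + replaced (suc l)) (ℤP.pos-* (suc (suc l)) (deleted (suc l))) ⟩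
        + deleted l +ℤ + suc (suc l) *ℤ + deleted (suc l) +ℤ + replaced (suc l)
      ∎ where open ≡-Reasoning

  ∸-suc-pred : ∀ n k → suc k ≤ n → n ∸ k ≡ suc (n ∸ suc k)
  ∸-suc-pred (suc n) zero _ = refl
  ∸-suc-pred (suc n) (suc k) (s≤s k<n) = ∸-suc-pred n k k<n


open import Defs
open import Data.Nat using (ℕ; _≤_; _∸_; _+_; pred; suc; s≤s; z≤n)
open import Data.Nat.Properties using (+-∸-comm; +-comm; <⇒≤)
open import Data.Integer using (+_) renaming (_+_ to _+ℤ_; _*_ to _*ℤ_)
open import Data.Fin using (Fin)
open import Data.List using (allFin; concatMap)
open import Data.Maybe using (nothing)
open import Relation.Binary.PropositionalEquality using (_≡_; cong; cong₂; sym; trans; module ≡-Reasoning)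
open LinearCombinations using (coeff-scale)
open Assembly

-- Write n = n' + 1, k = k' + 1 and L = n - k = l + 1.  The left-hand side is
-- Ins for all tiles of w; the insertion identity splits it into the
-- ν_k ∘ ∂_a term, (n + 1 - k) times the ν_{k-1} ∘ ∂_a term, and the θ-terms.
mainTheorem15 : (s n : ℕ) → 2 ≤ n → (a : Fin s) → (k : ℕ) → 1 ≤ k → k ≤ n ∸ 1 →
    (w : Word s n) → (u : Word s (pred n)) →
    coeff (lin (∂ a) (ν n k w)) u
    ≡ coeff (lin (ν (pred n) k) (∂ a w)) u
    +ℤ coeff (scale (+ (n + 1 ∸ k)) (lin (ν (pred n) (k ∸ 1)) (∂ a w))) u
    +ℤ coeff (concatMap (λ b → lin (θ a b) (lin (ν (pred n) (k ∸ 1)) (∂ b w))) (allFin s)) u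
mainTheorem15 s (suc (suc n'')) (s≤s (s≤s z≤n)) a (suc k') (s≤s z≤n) k<n' w u = begin
    coeff (lin (∂ a) (ν (suc n') (suc k') w)) u
  ≡⟨ coeff-∂ν (suc k') ⟩
    + Ins nothing L X u
  ≡⟨ insertion-tiles L l (∸-suc-pred n' k' k<n') ⟩
    + deleted l +ℤ + suc L *ℤ + deleted L +ℤ + replaced L
  ≡⟨ sym (cong₂ _+ℤ_ (cong₂ _+ℤ_ (coeff-ν∂ (suc k')) scaled-term) (coeff-θν∂ k')) ⟩
    coeff (lin (ν n' (suc k')) (∂ a w)) u
    +ℤ coeff (scale (+ (suc n' + 1 ∸ suc k')) (lin (ν n' k') (∂ a w))) u
    +ℤ coeff (concatMap (λ b → lin (θ a b) (lin (ν n' k') (∂ b w))) (allFin s)) u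
  ∎
  where
  open ≡-Reasoning
  n' = suc n''
  open Coefficients a w u
  L = n' ∸ k'
  l = n' ∸ suc k'
  factor : n' + 1 ∸ k' ≡ suc L
  factor = trans (+-∸-comm 1 (<⇒≤ k<n')) (+-comm L 1)
  scaled-term : coeff (scale (+ (suc n' + 1 ∸ suc k')) (lin (ν n' k') (∂ a w))) u ≡ + suc L *ℤ + deleted L
  scaled-term = trans (coeff-scale (+ (suc n' + 1 ∸ suc k')) (lin (ν n' k') (∂ a w)) u) (cong₂ _*ℤ_ (cong +_ factor) (coeff-ν∂ k'))
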